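{- Let $M\rightarrow M'$ be a matroid perspective on a finite linearly ordered set $E$, and write $t=t(M,M';x,y,z)$, $cr'=cr_{M'}(A)$, $\iota'=\iota_{M'}(A)$, $nl=nl_M(A)$, $\epsilon=\epsilon_M(A)$, $rcd=rcd_{M,M'}(A)$. Then each of the following holds: (1) $t=\sum_{A\subseteq E}(x-1)^{cr'}(y-1)^{nl}z^{rcd}$; (2) $t=\sum_{A}x^{\iota'}y^{\epsilon}z^{rcd}$, summed over $A\subseteq E$ spanning in $M'$ and independent in $M$; (3) $t=\sum_{A\subseteq E}(x/2)^{cr'+\iota'}(y/2)^{nl+\epsilon}z^{rcd}$; (3b) $t=\sum_{A\subseteq E}(x/2)^{cr'+\iota'}(y-1)^{nl}z^{rcd}$; (3c) $t=\sum_{A}(x/2)^{cr'+\iota'}y^{nl}z^{rcd}$, summed over $A\subseteq E$ with $\epsilon_M(A)=0$; (3d) $t=\sum_{A\subseteq E}(x-1)^{cr'}(y/2)^{nl+\epsilon}z^{rcd}$; (3e) $t=\sum_{A}x^{cr'}(y/2)^{nl+\epsilon}z^{rcd}$, summed over $A\subseteq E$ with $\iota_{M'}(A)=0$; (4) $t=\sum_{A}x^{\iota'}(y-1)^{nl}z^{rcd}$, summed over $A\subseteq E$ spanning in $M'$; (5) $t=\sum_{A}(x-1)^{cr'}y^{\epsilon}z^{rcd}$, summed over $A\subseteq E$ independent in $M$.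
   Context: A matroid perspective $M\rightarrow M'$ is a pair of matroids $M,M'$ on the same finite set $E$ such that every circuit of $M$ is a union of circuits of $M'$. For a matroid $N$ on $E$ with rank function $r_N$, $r(N)=r_N(E)$, and $A\subseteq E$: $cr_N(A)=r(N)-r_N(A)$, $nl_N(A)=|A|-r_N(A)$; $\epsilon_N(A)$ is the number of $e\in E\setminus A$ that are the smallest element of some circuit of $N$ contained in $A\cup\{e\}$; $\iota_N(A)$ is the number of $e\in A$ that are the smallest element of some cocircuit of $N$ contained in $(E\setminus A)\cup\{e\}$. $rcd_{M,M'}(A)=r(M)-r(M')-(r_M(A)-r_{M'}(A))$, and $t(M,M';x,y,z)=\sum_{A\subseteq E}(x-1)^{r(M')-r_{M'}(A)}(y-1)^{|A|-r_M(A)}z^{rcd_{M,M'}(A)}$. -}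

module Defs where

open import Data.Nat as ℕ using (ℕ; zero; suc; _∸_; _<_; _⊔_)
open import Data.Bool using (Bool; true; false; not; _∧_; _∨_; if_then_else_)
open import Data.Fin as Fin using (Fin; toℕ)
open import Data.Fin.Subset using (Subset; inside; outside; ⊥; ⊤; ⁅_⁆; _∈_; _∉_; _⊆_; _∪_; ∁; ∣_∣)
open import Data.Fin.Subset.Properties using (_∈?_; _⊆?_; _⊂?_)
open import Data.List using (List; []; _∷_; map; _++_; foldr)
open import Data.Bool.ListAction using (all; any)
open import Data.List.Base using (allFin)
open import Data.Vec using (Vec; []; _∷_; tabulate)
open import Data.Product using (∃; _×_)
open import Data.Rational using (ℚ; 0ℚ; 1ℚ; _+_; _*_)
open import Relation.Nullary.Decidable using (⌊_⌋)
open import Relation.Binary.PropositionalEquality using (_≡_)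

-- The ground set E is Fin n, linearly ordered by the usual order on Fin n.
-- Subsets of E are Data.Fin.Subset (characteristic vectors).

allSubsets : (n : ℕ) → List (Subset n)
allSubsets zero    = [] ∷ []
allSubsets (suc n) = map (inside ∷_) (allSubsets n) ++ map (outside ∷_) (allSubsets n)

record Matroid (n : ℕ) : Set where
  field
    indep     : Subset n → Bool
    indep-⊥   : indep ⊥ ≡ true
    indep-⊆   : ∀ {A B} → B ⊆ A → indep A ≡ true → indep B ≡ true
    indep-aug : ∀ {A B} → indep A ≡ true → indep B ≡ true → ∣ A ∣ < ∣ B ∣ →
                ∃ λ x → x ∈ B × x ∉ A × indep (A ∪ ⁅ x ⁆) ≡ true
open Matroid public

module _ {n : ℕ} where

  rk : Matroid n → Subset n → ℕ
  rk N A = foldr _⊔_ 0 (map (λ B → if ⌊ B ⊆? A ⌋ ∧ indep N B then ∣ B ∣ else 0) (allSubsets n))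

  rank : Matroid n → ℕ
  rank N = rk N ⊤

  minDep : (Subset n → Bool) → Subset n → Bool
  minDep I C = not (I C) ∧ all (λ D → not ⌊ D ⊂? C ⌋ ∨ I D) (allSubsets n)

  circuit : Matroid n → Subset n → Bool
  circuit N = minDep (indep N)

  -- independent sets of the dual matroid N*: complements of spanning sets
  dualIndep : Matroid n → Subset n → Bool
  dualIndep N A = ⌊ rk N (∁ A) ℕ.≟ rank N ⌋

  cocircuit : Matroid n → Subset n → Bool
  cocircuit N = minDep (dualIndep N)

  isMinOf : Fin n → Subset n → Bool
  isMinOf e C = ⌊ e ∈? C ⌋ ∧ all (λ f → not ⌊ f ∈? C ⌋ ∨ ⌊ toℕ e ℕ.≤? toℕ f ⌋) (allFin n)

  cr : Matroid n → Subset n → ℕ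
  cr N A = rank N ∸ rk N A

  nl : Matroid n → Subset n → ℕ
  nl N A = ∣ A ∣ ∸ rk N A

  ε : Matroid n → Subset n → ℕ
  ε N A = ∣ tabulate (λ e → not ⌊ e ∈? A ⌋ ∧
            any (λ C → circuit N C ∧ ⌊ C ⊆? (A ∪ ⁅ e ⁆) ⌋ ∧ isMinOf e C) (allSubsets n)) ∣

  ι : Matroid n → Subset n → ℕ
  ι N A = ∣ tabulate (λ e → ⌊ e ∈? A ⌋ ∧
            any (λ C → cocircuit N C ∧ ⌊ C ⊆? (∁ A ∪ ⁅ e ⁆) ⌋ ∧ isMinOf e C) (allSubsets n)) ∣

  -- rcd_{M,M'}(A) = r(M) - r(M') - (r_M(A) - r_{M'}(A))  (nonnegative for perspectives)
  rcd : Matroid n → Matroid n → Subset n → ℕ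
  rcd M M' A = (rank M ℕ.+ rk M' A) ∸ (rank M' ℕ.+ rk M A)

  spanning : Matroid n → Subset n → Bool
  spanning N A = ⌊ rk N A ℕ.≟ rank N ⌋

  -- matroid perspective M → M': every circuit of M is a union of circuits of M'
  -- (i.e. every element of a circuit C of M lies in a circuit of M' contained in C)
  Perspective : Matroid n → Matroid n → Set
  Perspective M M' = ∀ C → circuit M C ≡ true → ∀ e → e ∈ C →
                     ∃ λ C' → circuit M' C' ≡ true × C' ⊆ C × e ∈ C'

infixr 8 _^_
_^_ : ℚ → ℕ → ℚ
q ^ zero  = 1ℚ
q ^ suc k = q * (q ^ k)

ΣSub : (n : ℕ) → (Subset n → ℚ) → ℚ
ΣSub n f = foldr _+_ 0ℚ (map f (allSubsets n))

ΣSubWhen : (n : ℕ) → (Subset n → Bool) → (Subset n → ℚ) → ℚ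
ΣSubWhen n P f = ΣSub n (λ A → if P A then f A else 0ℚ)

tutte : {n : ℕ} → Matroid n → Matroid n → ℚ → ℚ → ℚ → ℚ
tutte {n} M M' x y z =
  ΣSub n (λ A → ((x Data.Rational.- 1ℚ) ^ (rank M' ∸ rk M' A))
              * ((y Data.Rational.- 1ℚ) ^ (∣ A ∣ ∸ rk M A))
              * (z ^ rcd M M' A))

isZero : ℕ → Bool
isZero zero    = true
isZero (suc _) = false

module Submission where

-- The five statistics cr', nl, ε, ι',
-- rcd are interpolated by levels k ≤ n: at level k they are measured only on the
-- elements below k, so level n gives the statistics of the theorem and level 0 gives
-- zeros.  Activities are read off the rank functions: e ∉ B is externally active iff
-- e ∈ cl_M(B ∩ {> e}), and e ∈ B is internally active iff e ∉ cl_M'((B ∩ {> e}) ∪ {< e}).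
--
-- A weight for s is a function w(a, p) of two counters that is multiplied by a factor
-- `absent` (resp. `present`) when a (resp. p) grows, the two factors summing to s.
-- Weight independence: for weights U for x and V for y, the sum of U(cr', ι')·V(ε, nl)·z^rcd
-- over the B agreeing with a fixed A on the elements ≥ k does not depend on U and V.  Releasing e = k splits the sum into the halves e ∉ B
-- and e ∈ B; for inactive e the statistics move in a weight-free way, and for active e
-- the halves coincide for the Tutte weights (x-1)^cr', (y-1)^nl, so that only
-- absent + present = x (resp. y) matters.  The nine identities are nine choices of (U, V).

open import Data.Nat as ℕ using (ℕ; zero; suc; _≤_; _<_; z≤n; s≤s; _<ᵇ_; _≡ᵇ_; _+_; _∸_; _⊔_)
import Data.Nat.Properties as ℕP
open import Data.Bool using (Bool; true; false; not; _∧_; _∨_; if_then_else_)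
import Data.Bool.Properties as 𝔹P
open import Data.Bool.ListAction using (all; any)
open import Data.Fin using (Fin; toℕ; zero; suc; fromℕ<)
import Data.Fin.Properties as FinP
open import Data.Vec using ([]; _∷_; lookup; tabulate)
open import Data.Vec.Properties
  using (lookup-zipWith; lookup-map; lookup-replicate; lookup∘tabulate; tabulate-cong; []=⇒lookup; lookup⇒[]=)
open import Data.Fin.Subset hiding (_-_)
open import Data.Fin.Subset.Properties
  using (_∈?_; _⊆?_; _⊂?_; p⊆q⇒∣p∣≤∣q∣; p⊂q⇒∣p∣<∣q∣; ⊆-refl; ⊆-trans; ⊆⊤; ⊥⊆; ∣⊥∣≡0;
         p⊆p∪q; q⊆p∪q; ∪-assoc; ∪-identityˡ; ∪-identityʳ; ∪-zeroˡ; ∩-zeroʳ; ∩-identityʳ;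
         p─⊥≡p; p─⊤≡⊥; p─q⊆p; x∈p⇒p-x⊂p)
open import Data.List as L using (List; []; _∷_; _++_)
import Data.List.Properties as LP
import Data.List.Membership.Propositional as LM
open import Data.List.Membership.Propositional.Properties using (∈-map⁺; ∈-++⁺ˡ; ∈-++⁺ʳ; ∈-allFin)
open import Data.List.Relation.Unary.Any using (here; there)
open import Data.Product using (∃; _×_; _,_; proj₁; proj₂)
open import Data.Sum using (_⊎_; inj₁; inj₂; [_,_]′)
open import Data.Empty using (⊥-elim) renaming (⊥ to False)
open import Relation.Nullary using (¬_; Dec; yes; no)
open import Relation.Nullary.Decidable using (⌊_⌋)
open import Relation.Binary.Definitions using (tri<; tri≈; tri>)
open import Relation.Binary.PropositionalEquality hiding ([_])
open import Function using (_∘_)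
open import Data.Rational using (ℚ; 0ℚ; 1ℚ; ½; _*_; _-_) renaming (_+_ to _+ℚ_)
import Data.Rational.Properties as ℚP
open import Data.Rational.Solver using (module +-*-Solver)
open +-*-Solver using (solve; _:=_; _:*_; _:+_; _:-_; con)
open import Defs

private variable n : ℕ

∧-split : {a b : Bool} → (a ∧ b) ≡ true → a ≡ true × b ≡ true
∧-split {true} {true} _ = refl , refl

∧-intro : {a b : Bool} → a ≡ true → b ≡ true → (a ∧ b) ≡ true
∧-intro refl refl = refl

∨-split : {a b : Bool} → (a ∨ b) ≡ true → a ≡ true ⊎ b ≡ true
∨-split {true} _ = inj₁ refl
∨-split {false} {true} _ = inj₂ refl

∨-introˡ : {a b : Bool} → a ≡ true → (a ∨ b) ≡ true
∨-introˡ refl = refl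

∨-introʳ : {a b : Bool} → b ≡ true → (a ∨ b) ≡ true
∨-introʳ {true} _ = refl
∨-introʳ {false} refl = refl

not-true : {a : Bool} → not a ≡ true → a ≡ false
not-true {false} _ = refl

not-false : {a : Bool} → a ≡ false → not a ≡ true
not-false refl = refl

true≢false : {a : Bool} → a ≡ true → a ≡ false → False
true≢false refl ()

bool-ext : {a b : Bool} → (a ≡ true → b ≡ true) → (b ≡ true → a ≡ true) → a ≡ b
bool-ext {true} {true} f g = refl
bool-ext {true} {false} f g = sym (f refl)
bool-ext {false} {true} f g = g refl
bool-ext {false} {false} f g = refl

⌊⌋-true : {P : Set} (d : Dec P) → P → ⌊ d ⌋ ≡ true
⌊⌋-true (yes _) _ = refl
⌊⌋-true (no ¬p) p = ⊥-elim (¬p p)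

⌊⌋-false : {P : Set} (d : Dec P) → ¬ P → ⌊ d ⌋ ≡ false
⌊⌋-false (yes p) ¬p = ⊥-elim (¬p p)
⌊⌋-false (no _) _ = refl

⌊⌋-elim : {P : Set} (d : Dec P) → ⌊ d ⌋ ≡ true → P
⌊⌋-elim (yes p) _ = p

⌊⌋-elim' : {P : Set} (d : Dec P) → ⌊ d ⌋ ≡ false → ¬ P
⌊⌋-elim' (no ¬p) _ = ¬p

≡ᵇ-refl : (k : ℕ) → (k ≡ᵇ k) ≡ true
≡ᵇ-refl zero = refl
≡ᵇ-refl (suc k) = ≡ᵇ-refl k

≡ᵇ⇒≡ : (a b : ℕ) → (a ≡ᵇ b) ≡ true → a ≡ b
≡ᵇ⇒≡ zero zero _ = refl
≡ᵇ⇒≡ (suc a) (suc b) p = cong suc (≡ᵇ⇒≡ a b p)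

≢⇒≡ᵇ : (a b : ℕ) → ¬ a ≡ b → (a ≡ᵇ b) ≡ false
≢⇒≡ᵇ zero zero h = ⊥-elim (h refl)
≢⇒≡ᵇ zero (suc b) h = refl
≢⇒≡ᵇ (suc a) zero h = refl
≢⇒≡ᵇ (suc a) (suc b) h = ≢⇒≡ᵇ a b (h ∘ cong suc)

<ᵇ⇒< : (a b : ℕ) → (a <ᵇ b) ≡ true → a < b
<ᵇ⇒< zero (suc b) _ = s≤s z≤n
<ᵇ⇒< (suc a) (suc b) h = s≤s (<ᵇ⇒< a b h)

<⇒<ᵇ : (a b : ℕ) → a < b → (a <ᵇ b) ≡ true
<⇒<ᵇ zero (suc b) _ = refl
<⇒<ᵇ (suc a) (suc b) (s≤s h) = <⇒<ᵇ a b h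

≮⇒<ᵇ : (a b : ℕ) → ¬ a < b → (a <ᵇ b) ≡ false
≮⇒<ᵇ a b h with a <ᵇ b in eq
... | true = ⊥-elim (h (<ᵇ⇒< a b eq))
... | false = refl

<ᵇ-false⇒≥ : (a b : ℕ) → (a <ᵇ b) ≡ false → b ≤ a
<ᵇ-false⇒≥ a b h with ℕP.<-≤-connex a b
... | inj₁ lt = ⊥-elim (true≢false (<⇒<ᵇ a b lt) h)
... | inj₂ le = le

<ᵇ-irrefl : (k : ℕ) → (k <ᵇ k) ≡ false
<ᵇ-irrefl zero = refl
<ᵇ-irrefl (suc k) = <ᵇ-irrefl k

<ᵇ-suc : (k : ℕ) → (k <ᵇ suc k) ≡ true
<ᵇ-suc zero = refl
<ᵇ-suc (suc k) = <ᵇ-suc k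

subset-ext : {X Y : Subset n} → (∀ i → lookup X i ≡ lookup Y i) → X ≡ Y
subset-ext {X = []} {[]} _ = refl
subset-ext {X = x ∷ X} {y ∷ Y} h = cong₂ _∷_ (h zero) (subset-ext (h ∘ suc))

lookup-∪ : (X Y : Subset n) (i : Fin n) → lookup (X ∪ Y) i ≡ (lookup X i ∨ lookup Y i)
lookup-∪ X Y i = lookup-zipWith _∨_ i X Y

lookup-∩ : (X Y : Subset n) (i : Fin n) → lookup (X ∩ Y) i ≡ (lookup X i ∧ lookup Y i)
lookup-∩ X Y i = lookup-zipWith _∧_ i X Y

lookup-∁ : (X : Subset n) (i : Fin n) → lookup (∁ X) i ≡ not (lookup X i)
lookup-∁ X i = lookup-map i not X

lookup-⊥ : (i : Fin n) → lookup (⊥ {n}) i ≡ false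
lookup-⊥ i = lookup-replicate i false

lookup-⊤ : (i : Fin n) → lookup (⊤ {n}) i ≡ true
lookup-⊤ i = lookup-replicate i true

lookup-─ : (X Y : Subset n) (i : Fin n) → lookup (X ─ Y) i ≡ (lookup X i ∧ not (lookup Y i))
lookup-─ (x ∷ X) (true ∷ Y) zero = sym (𝔹P.∧-zeroʳ x)
lookup-─ (x ∷ X) (false ∷ Y) zero = sym (𝔹P.∧-identityʳ x)
lookup-─ (x ∷ X) (y ∷ Y) (suc i) = lookup-─ X Y i

lookup-⁅⁆ : (e i : Fin n) → lookup ⁅ e ⁆ i ≡ (toℕ i ≡ᵇ toℕ e)
lookup-⁅⁆ zero zero = refl
lookup-⁅⁆ zero (suc i) = lookup-⊥ i
lookup-⁅⁆ (suc e) zero = refl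
lookup-⁅⁆ (suc e) (suc i) = lookup-⁅⁆ e i

lookup-⁅⁆-self : (e : Fin n) → lookup ⁅ e ⁆ e ≡ true
lookup-⁅⁆-self e = trans (lookup-⁅⁆ e e) (≡ᵇ-refl (toℕ e))

lookup-⁅⁆-other : {i e : Fin n} → ¬ i ≡ e → lookup ⁅ e ⁆ i ≡ false
lookup-⁅⁆-other {i = i} {e} h = trans (lookup-⁅⁆ e i) (≢⇒≡ᵇ (toℕ i) (toℕ e) (h ∘ FinP.toℕ-injective))

lookup-⁅⁆⇒≡ : {i e : Fin n} → lookup ⁅ e ⁆ i ≡ true → i ≡ e
lookup-⁅⁆⇒≡ {i = i} {e} h = FinP.toℕ-injective (≡ᵇ⇒≡ (toℕ i) (toℕ e) (trans (sym (lookup-⁅⁆ e i)) h))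

∈⇒lookup : {x : Fin n} {p : Subset n} → x ∈ p → lookup p x ≡ true
∈⇒lookup = []=⇒lookup

lookup⇒∈ : {x : Fin n} {p : Subset n} → lookup p x ≡ true → x ∈ p
lookup⇒∈ {x = x} {p} = lookup⇒[]= x p

∉⇒lookup : {x : Fin n} {p : Subset n} → ¬ x ∈ p → lookup p x ≡ false
∉⇒lookup {x = x} {p} h with lookup p x in eq
... | true = ⊥-elim (h (lookup⇒∈ eq))
... | false = refl

lookup∈? : (x : Fin n) (p : Subset n) → ⌊ x ∈? p ⌋ ≡ lookup p x
lookup∈? x p = bool-ext (λ h → ∈⇒lookup (⌊⌋-elim (x ∈? p) h)) (λ h → ⌊⌋-true (x ∈? p) (lookup⇒∈ h))

⊆-byLookup : {X Y : Subset n} → (∀ i → lookup X i ≡ true → lookup Y i ≡ true) → X ⊆ Y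
⊆-byLookup h x∈ = lookup⇒∈ (h _ (∈⇒lookup x∈))

lookup-⊆ : {X Y : Subset n} → X ⊆ Y → ∀ i → lookup X i ≡ true → lookup Y i ≡ true
lookup-⊆ h i p = ∈⇒lookup (h (lookup⇒∈ p))

lookup-∪⁺ˡ : (X Y : Subset n) (i : Fin n) → lookup X i ≡ true → lookup (X ∪ Y) i ≡ true
lookup-∪⁺ˡ X Y i h = trans (lookup-∪ X Y i) (∨-introˡ h)

lookup-∪⁺ʳ : (X Y : Subset n) (i : Fin n) → lookup Y i ≡ true → lookup (X ∪ Y) i ≡ true
lookup-∪⁺ʳ X Y i h = trans (lookup-∪ X Y i) (∨-introʳ {lookup X i} h)

lookup-∪⁻ : (X Y : Subset n) (i : Fin n) → lookup (X ∪ Y) i ≡ true → lookup X i ≡ true ⊎ lookup Y i ≡ true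
lookup-∪⁻ X Y i h = ∨-split (trans (sym (lookup-∪ X Y i)) h)

lookup-∪⁅⁆⁻ : (X : Subset n) (e i : Fin n) → lookup (X ∪ ⁅ e ⁆) i ≡ true → lookup X i ≡ true ⊎ i ≡ e
lookup-∪⁅⁆⁻ X e i h with lookup-∪⁻ X ⁅ e ⁆ i h
... | inj₁ p = inj₁ p
... | inj₂ p = inj₂ (lookup-⁅⁆⇒≡ p)

lookup-∩⁺ : (X Y : Subset n) (i : Fin n) → lookup X i ≡ true → lookup Y i ≡ true → lookup (X ∩ Y) i ≡ true
lookup-∩⁺ X Y i a b = trans (lookup-∩ X Y i) (∧-intro a b)

lookup-∩⁻ : (X Y : Subset n) (i : Fin n) → lookup (X ∩ Y) i ≡ true → lookup X i ≡ true × lookup Y i ≡ true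
lookup-∩⁻ X Y i h = ∧-split (trans (sym (lookup-∩ X Y i)) h)

lookup-─⁅⁆⁻ : (C : Subset n) (e i : Fin n) → lookup (C ─ ⁅ e ⁆) i ≡ true → lookup C i ≡ true × ¬ i ≡ e
lookup-─⁅⁆⁻ C e i h with ∧-split {lookup C i} (trans (sym (lookup-─ C ⁅ e ⁆ i)) h)
... | ci , nse = ci , λ { refl → true≢false (lookup-⁅⁆-self i) (not-true nse) }

∪-lub : {X Y Z : Subset n} → X ⊆ Z → Y ⊆ Z → X ∪ Y ⊆ Z
∪-lub {X = X} {Y} {Z} a b = ⊆-byLookup λ i h → [ lookup-⊆ a i , lookup-⊆ b i ]′ (lookup-∪⁻ X Y i h)

∪-mono : {X Y Z W : Subset n} → X ⊆ Z → Y ⊆ W → X ∪ Y ⊆ Z ∪ W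
∪-mono {Z = Z} {W} a b = ∪-lub (p⊆p∪q W ∘ a) (q⊆p∪q Z W ∘ b)

∪-swap : (X Y Z : Subset n) → (X ∪ Y) ∪ Z ≡ (X ∪ Z) ∪ Y
∪-swap X Y Z = subset-ext λ i → begin
    lookup ((X ∪ Y) ∪ Z) i                     ≡⟨ lookup-∪ (X ∪ Y) Z i ⟩
    lookup (X ∪ Y) i ∨ lookup Z i              ≡⟨ cong (_∨ lookup Z i) (lookup-∪ X Y i) ⟩
    (lookup X i ∨ lookup Y i) ∨ lookup Z i     ≡⟨ swap (lookup X i) (lookup Y i) (lookup Z i) ⟩
    (lookup X i ∨ lookup Z i) ∨ lookup Y i     ≡⟨ cong (_∨ lookup Y i) (sym (lookup-∪ X Z i)) ⟩
    lookup (X ∪ Z) i ∨ lookup Y i              ≡⟨ sym (lookup-∪ (X ∪ Z) Y i) ⟩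
    lookup ((X ∪ Z) ∪ Y) i                     ∎
  where
  open ≡-Reasoning
  swap : ∀ a b c → ((a ∨ b) ∨ c) ≡ ((a ∨ c) ∨ b)
  swap true b c = refl
  swap false true true = refl
  swap false true false = refl
  swap false false c = sym (𝔹P.∨-identityʳ c)

∁-involutive : (X : Subset n) → ∁ (∁ X) ≡ X
∁-involutive X = subset-ext λ i → trans (lookup-∁ (∁ X) i) (trans (cong not (lookup-∁ X i)) (𝔹P.not-involutive _))

∁-─⁅⁆ : (C : Subset n) (e : Fin n) → ∁ (C ─ ⁅ e ⁆) ≡ ∁ C ∪ ⁅ e ⁆
∁-─⁅⁆ C e = subset-ext λ i → begin
    lookup (∁ (C ─ ⁅ e ⁆)) i                   ≡⟨ lookup-∁ (C ─ ⁅ e ⁆) i ⟩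
    not (lookup (C ─ ⁅ e ⁆) i)                 ≡⟨ cong not (lookup-─ C ⁅ e ⁆ i) ⟩
    not (lookup C i ∧ not (lookup ⁅ e ⁆ i))    ≡⟨ deMorgan (lookup C i) (lookup ⁅ e ⁆ i) ⟩
    not (lookup C i) ∨ lookup ⁅ e ⁆ i          ≡⟨ cong (_∨ lookup ⁅ e ⁆ i) (sym (lookup-∁ C i)) ⟩
    lookup (∁ C) i ∨ lookup ⁅ e ⁆ i            ≡⟨ sym (lookup-∪ (∁ C) ⁅ e ⁆ i) ⟩
    lookup (∁ C ∪ ⁅ e ⁆) i                     ∎
  where
  open ≡-Reasoning
  deMorgan : ∀ a b → not (a ∧ not b) ≡ (not a ∨ b)
  deMorgan true true = refl
  deMorgan true false = refl
  deMorgan false b = refl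

∪⁅⁆-absorb : (Y : Subset n) (e : Fin n) → lookup Y e ≡ true → Y ∪ ⁅ e ⁆ ≡ Y
∪⁅⁆-absorb Y e h = subset-ext λ i → trans (lookup-∪ Y ⁅ e ⁆ i) (atPosition i)
  where
  atPosition : ∀ i → (lookup Y i ∨ lookup ⁅ e ⁆ i) ≡ lookup Y i
  atPosition i with i FinP.≟ e
  ... | yes refl rewrite h = refl
  ... | no i≢e rewrite lookup-⁅⁆-other i≢e = 𝔹P.∨-identityʳ _

─⁅⁆-∪⁅⁆ : (B : Subset n) (e : Fin n) → lookup B e ≡ true → (B ─ ⁅ e ⁆) ∪ ⁅ e ⁆ ≡ B
─⁅⁆-∪⁅⁆ B e h = subset-ext atPosition
  where
  atPosition : ∀ i → lookup ((B ─ ⁅ e ⁆) ∪ ⁅ e ⁆) i ≡ lookup B i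
  atPosition i with i FinP.≟ e
  ... | yes refl rewrite lookup-∪ (B ─ ⁅ e ⁆) ⁅ e ⁆ e | lookup-⁅⁆-self e | h = 𝔹P.∨-zeroʳ _
  ... | no i≢e rewrite lookup-∪ (B ─ ⁅ e ⁆) ⁅ e ⁆ i | lookup-─ B ⁅ e ⁆ i | lookup-⁅⁆-other i≢e =
    trans (𝔹P.∨-identityʳ _) (𝔹P.∧-identityʳ _)

─⁅⁆-⊆ : (B X : Subset n) (e : Fin n) → B ⊆ X ∪ ⁅ e ⁆ → B ─ ⁅ e ⁆ ⊆ X
─⁅⁆-⊆ B X e h = ⊆-byLookup λ i q → let (bi , i≢e) = lookup-─⁅⁆⁻ B e i q in
  [ (λ xi → xi) , (λ i≡e → ⊥-elim (i≢e i≡e)) ]′ (lookup-∪⁅⁆⁻ X e i (lookup-⊆ h i bi))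

⊆-∪⁅⁆-∉ : {B X : Subset n} {e : Fin n} → B ⊆ X ∪ ⁅ e ⁆ → lookup B e ≡ false → B ⊆ X
⊆-∪⁅⁆-∉ {B = B} {X} {e} h be = ⊆-byLookup λ i bi →
  [ (λ xi → xi) , (λ { refl → ⊥-elim (true≢false bi be) }) ]′ (lookup-∪⁅⁆⁻ X e i (lookup-⊆ h i bi))

∣∪⁅⁆∣ : (p : Subset n) (e : Fin n) → lookup p e ≡ false → ∣ p ∪ ⁅ e ⁆ ∣ ≡ suc ∣ p ∣
∣∪⁅⁆∣ (false ∷ p) zero h = cong suc (cong ∣_∣ (∪-identityʳ p))
∣∪⁅⁆∣ (true ∷ p) (suc e) h = cong suc (∣∪⁅⁆∣ p e h)
∣∪⁅⁆∣ (false ∷ p) (suc e) h = ∣∪⁅⁆∣ p e h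

∣─⁅⁆∣ : (p : Subset n) (e : Fin n) → lookup p e ≡ true → ∣ p ∣ ≡ suc ∣ p ─ ⁅ e ⁆ ∣
∣─⁅⁆∣ (true ∷ p) zero h = cong suc (cong ∣_∣ (sym (p─⊥≡p p)))
∣─⁅⁆∣ (true ∷ p) (suc e) h = cong suc (∣─⁅⁆∣ p e h)
∣─⁅⁆∣ (false ∷ p) (suc e) h = ∣─⁅⁆∣ p e h

⊆-∣∣-≡ : (p q : Subset n) → (∀ i → lookup p i ≡ true → lookup q i ≡ true) → ∣ q ∣ ≤ ∣ p ∣ → p ≡ q
⊆-∣∣-≡ [] [] h le = refl
⊆-∣∣-≡ (true ∷ p) (true ∷ q) h (s≤s le) = cong (true ∷_) (⊆-∣∣-≡ p q (h ∘ suc) le)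
⊆-∣∣-≡ (true ∷ p) (false ∷ q) h le with h zero refl
... | ()
⊆-∣∣-≡ (false ∷ p) (false ∷ q) h le = cong (false ∷_) (⊆-∣∣-≡ p q (h ∘ suc) le)
⊆-∣∣-≡ (false ∷ p) (true ∷ q) h le =
  ⊥-elim (ℕP.<-irrefl refl (ℕP.≤-trans le (p⊆q⇒∣p∣≤∣q∣ {p = p} {q} (⊆-byLookup (h ∘ suc)))))

-- Sums over subsets with a fixed part.  ΣBelow k A f sums f over the 2^k subsets B
-- that agree with A at every position ≥ k; position k-1 is split first, so the
-- recursion matches the induction on levels of the main argument.

setAt : ℕ → Bool → Subset n → Subset n
setAt _ b [] = []
setAt zero b (_ ∷ A) = b ∷ A
setAt (suc k) b (a ∷ A) = a ∷ setAt k b A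

lookup-setAt : (k : ℕ) (b : Bool) (A : Subset n) (i : Fin n) →
               lookup (setAt k b A) i ≡ (if toℕ i ≡ᵇ k then b else lookup A i)
lookup-setAt zero b (a ∷ A) zero = refl
lookup-setAt (suc k) b (a ∷ A) zero = refl
lookup-setAt zero b (a ∷ A) (suc i) = refl
lookup-setAt (suc k) b (a ∷ A) (suc i) = lookup-setAt k b A i

setAt-setAt : (k : ℕ) (a b : Bool) (A : Subset n) → setAt k a (setAt k b A) ≡ setAt k a A
setAt-setAt k a b [] = refl
setAt-setAt zero a b (x ∷ A) = refl
setAt-setAt (suc k) a b (x ∷ A) = cong (x ∷_) (setAt-setAt k a b A)

setAt-comm : (j k : ℕ) → ¬ j ≡ k → (a b : Bool) (A : Subset n) →
             setAt j a (setAt k b A) ≡ setAt k b (setAt j a A)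
setAt-comm j k ne a b [] = refl
setAt-comm zero zero ne a b (x ∷ A) = ⊥-elim (ne refl)
setAt-comm zero (suc k) ne a b (x ∷ A) = refl
setAt-comm (suc j) zero ne a b (x ∷ A) = refl
setAt-comm (suc j) (suc k) ne a b (x ∷ A) = cong (x ∷_) (setAt-comm j k (ne ∘ cong suc) a b A)

ΣBelow : ℕ → Subset n → (Subset n → ℚ) → ℚ
ΣBelow zero A f = f A
ΣBelow (suc k) A f = ΣBelow k (setAt k false A) f +ℚ ΣBelow k (setAt k true A) f

-- B agrees with A at all positions ≥ k: these are the B summed by ΣBelow k A.
AgreeFrom : ℕ → Subset n → Subset n → Set
AgreeFrom k A B = ∀ i → k ≤ toℕ i → lookup B i ≡ lookup A i

agreeFrom-step : (k : ℕ) (b : Bool) (A B : Subset n) → AgreeFrom k (setAt k b A) B → AgreeFrom (suc k) A B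
agreeFrom-step k b A B ag i le = trans (ag i (ℕP.≤-trans (ℕP.n≤1+n k) le))
  (trans (lookup-setAt k b A i)
         (cong (λ c → if c then b else lookup A i) (≢⇒≡ᵇ (toℕ i) k (λ eq → ℕP.<-irrefl (sym eq) le))))

ΣBelow-cong : (k : ℕ) (A : Subset n) (f g : Subset n → ℚ) →
              (∀ B → AgreeFrom k A B → f B ≡ g B) → ΣBelow k A f ≡ ΣBelow k A g
ΣBelow-cong zero A f g h = h A (λ i _ → refl)
ΣBelow-cong (suc k) A f g h = cong₂ _+ℚ_
  (ΣBelow-cong k (setAt k false A) f g (λ B ag → h B (agreeFrom-step k false A B ag)))
  (ΣBelow-cong k (setAt k true A) f g (λ B ag → h B (agreeFrom-step k true A B ag)))

ΣBelow-scale : (k : ℕ) (A : Subset n) (c : ℚ) (f : Subset n → ℚ) →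
               ΣBelow k A (λ B → c * f B) ≡ c * ΣBelow k A f
ΣBelow-scale zero A c f = refl
ΣBelow-scale (suc k) A c f =
  trans (cong₂ _+ℚ_ (ΣBelow-scale k _ c f) (ΣBelow-scale k _ c f)) (sym (ℚP.*-distribˡ-+ c _ _))

ΣBelow-setAt : (j k : ℕ) → j ≤ k → (A : Subset n) (f : Subset n → ℚ) →
               ΣBelow j (setAt k true A) f ≡ ΣBelow j (setAt k false A) (f ∘ setAt k true)
ΣBelow-setAt zero k le A f = cong f (sym (setAt-setAt k true false A))
ΣBelow-setAt (suc j) k le A f = cong₂ _+ℚ_ (branch false) (branch true)
  where
  j≤k : j ≤ k
  j≤k = ℕP.≤-trans (ℕP.n≤1+n j) le
  j≢k : ¬ j ≡ k
  j≢k eq = ℕP.<-irrefl eq le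
  branch : (b : Bool) → ΣBelow j (setAt j b (setAt k true A)) f
                      ≡ ΣBelow j (setAt j b (setAt k false A)) (f ∘ setAt k true)
  branch b = begin
    ΣBelow j (setAt j b (setAt k true A)) f
      ≡⟨ cong (λ X → ΣBelow j X f) (setAt-comm j k j≢k b true A) ⟩
    ΣBelow j (setAt k true (setAt j b A)) f
      ≡⟨ ΣBelow-setAt j k j≤k (setAt j b A) f ⟩
    ΣBelow j (setAt k false (setAt j b A)) (f ∘ setAt k true)
      ≡⟨ cong (λ X → ΣBelow j X (f ∘ setAt k true)) (sym (setAt-comm j k j≢k b false A)) ⟩
    ΣBelow j (setAt j b (setAt k false A)) (f ∘ setAt k true) ∎
    where open ≡-Reasoning

private
  sumℚ : List ℚ → ℚ
  sumℚ = L.foldr _+ℚ_ 0ℚ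

  sumℚ-++ : (xs ys : List ℚ) → sumℚ (xs ++ ys) ≡ sumℚ xs +ℚ sumℚ ys
  sumℚ-++ [] ys = sym (ℚP.+-identityˡ _)
  sumℚ-++ (x ∷ xs) ys = trans (cong (x +ℚ_) (sumℚ-++ xs ys)) (sym (ℚP.+-assoc x _ _))

  +ℚ-interchange : (a b c d : ℚ) → (a +ℚ b) +ℚ (c +ℚ d) ≡ (a +ℚ c) +ℚ (b +ℚ d)
  +ℚ-interchange = solve 4 (λ a b c d → (a :+ b) :+ (c :+ d) := (a :+ c) :+ (b :+ d)) refl

ΣSub-cong : (f g : Subset n → ℚ) → (∀ A → f A ≡ g A) → ΣSub n f ≡ ΣSub n g
ΣSub-cong {n} f g h = cong sumℚ (LP.map-cong h (allSubsets n))

ΣSub-suc : (f : Subset (suc n) → ℚ) →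
           ΣSub (suc n) f ≡ ΣSub n (λ B → f (true ∷ B)) +ℚ ΣSub n (λ B → f (false ∷ B))
ΣSub-suc {n} f = trans
  (cong sumℚ (trans (LP.map-++ f (L.map (true ∷_) (allSubsets n)) _)
                    (cong₂ _++_ (sym (LP.map-∘ (allSubsets n))) (sym (LP.map-∘ (allSubsets n))))))
  (sumℚ-++ (L.map (λ B → f (true ∷ B)) (allSubsets n)) (L.map (λ B → f (false ∷ B)) (allSubsets n)))

ΣBelow-suc : (k : ℕ) (b : Bool) (A : Subset n) (f : Subset (suc n) → ℚ) →
  ΣBelow (suc k) (b ∷ A) f ≡ ΣBelow k A (λ B → f (true ∷ B)) +ℚ ΣBelow k A (λ B → f (false ∷ B))
ΣBelow-suc zero b A f = ℚP.+-comm (f (false ∷ A)) (f (true ∷ A))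
ΣBelow-suc (suc k) b A f =
  trans (cong₂ _+ℚ_ (ΣBelow-suc k b (setAt k false A) f) (ΣBelow-suc k b (setAt k true A) f))
        (+ℚ-interchange (half false true) (half false false) (half true true) (half true false))
  where
  half : Bool → Bool → ℚ
  half b c = ΣBelow k (setAt k b A) (λ B → f (c ∷ B))

ΣBelow-all : (A : Subset n) (f : Subset n → ℚ) → ΣBelow n A f ≡ ΣSub n f
ΣBelow-all [] f = sym (ℚP.+-identityʳ (f []))
ΣBelow-all {suc n} (b ∷ A) f =
  trans (ΣBelow-suc n b A f) (trans (cong₂ _+ℚ_ (ΣBelow-all A _) (ΣBelow-all A _)) (sym (ΣSub-suc f)))

allSubsets-complete : (B : Subset n) → B LM.∈ allSubsets n
allSubsets-complete [] = here refl
allSubsets-complete {suc n} (true ∷ B) = ∈-++⁺ˡ (∈-map⁺ (true ∷_) (allSubsets-complete B))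
allSubsets-complete {suc n} (false ∷ B) =
  ∈-++⁺ʳ (L.map (true ∷_) (allSubsets n)) (∈-map⁺ (false ∷_) (allSubsets-complete B))

module _ {A : Set} (p : A → Bool) where

  all-elim : (xs : List A) → all p xs ≡ true → ∀ {x} → x LM.∈ xs → p x ≡ true
  all-elim (y ∷ xs) h (here refl) = proj₁ (∧-split {p y} h)
  all-elim (y ∷ xs) h (there m) = all-elim xs (proj₂ (∧-split {p y} h)) m

  all-intro : (xs : List A) → (∀ x → p x ≡ true) → all p xs ≡ true
  all-intro [] f = refl
  all-intro (y ∷ xs) f rewrite f y = all-intro xs f

  all-false : (xs : List A) → all p xs ≡ false → ∃ λ x → p x ≡ false
  all-false (y ∷ xs) h with p y in eq
  ... | false = y , eq
  ... | true = all-false xs h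

  any-intro : (xs : List A) → ∀ {x} → x LM.∈ xs → p x ≡ true → any p xs ≡ true
  any-intro (y ∷ xs) (here refl) h rewrite h = refl
  any-intro (y ∷ xs) (there m) h = ∨-introʳ {p y} (any-intro xs m h)

  any-elim : (xs : List A) → any p xs ≡ true → ∃ λ x → p x ≡ true
  any-elim (y ∷ xs) h with p y in eq
  ... | true = y , eq
  ... | false = any-elim xs h

module Rank {n : ℕ} (N : Matroid n) where

  private
    candidate : Subset n → Subset n → ℕ
    candidate A B = if ⌊ B ⊆? A ⌋ ∧ indep N B then ∣ B ∣ else 0

    foldr-⊔-≥ : (f : Subset n → ℕ) (xs : List (Subset n)) → ∀ {x} → x LM.∈ xs →
                f x ≤ L.foldr _⊔_ 0 (L.map f xs)
    foldr-⊔-≥ f (y ∷ xs) (here refl) = ℕP.m≤m⊔n (f y) _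
    foldr-⊔-≥ f (y ∷ xs) (there m) = ℕP.≤-trans (foldr-⊔-≥ f xs m) (ℕP.m≤n⊔m (f y) _)

    attained : (A : Subset n) (xs : List (Subset n)) →
               ∃ λ B → (B ⊆ A × indep N B ≡ true) × ∣ B ∣ ≡ L.foldr _⊔_ 0 (L.map (candidate A) xs)
    attained A [] = ⊥ , (⊥⊆ , indep-⊥ N) , ∣⊥∣≡0 n
    attained A (y ∷ xs) with attained A xs
    ... | B , good , eB with ℕP.≤-total (candidate A y) (L.foldr _⊔_ 0 (L.map (candidate A) xs))
    ...   | inj₁ le = B , good , trans eB (sym (ℕP.m≤n⇒m⊔n≡n le))
    ...   | inj₂ ge with y ⊆? A | indep N y in iy
    ...     | yes y⊆A | true = y , (y⊆A , iy) , sym (ℕP.m≥n⇒m⊔n≡m ge)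
    ...     | yes _ | false = B , good , eB
    ...     | no _ | _ = B , good , eB

  rk-≥ : ∀ {A B} → B ⊆ A → indep N B ≡ true → ∣ B ∣ ≤ rk N A
  rk-≥ {A} {B} B⊆A iB = subst (_≤ rk N A) value (foldr-⊔-≥ (candidate A) (allSubsets n) (allSubsets-complete B))
    where
    value : candidate A B ≡ ∣ B ∣
    value rewrite ⌊⌋-true (B ⊆? A) B⊆A | iB = refl

  basis : (A : Subset n) → ∃ λ B → (B ⊆ A × indep N B ≡ true) × ∣ B ∣ ≡ rk N A
  basis A = attained A (allSubsets n)

  rk-≤-∣∣ : (A : Subset n) → rk N A ≤ ∣ A ∣
  rk-≤-∣∣ A with basis A
  ... | B , (B⊆A , _) , eB = subst (_≤ ∣ A ∣) eB (p⊆q⇒∣p∣≤∣q∣ B⊆A)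

  rk-mono : ∀ {A A'} → A ⊆ A' → rk N A ≤ rk N A'
  rk-mono {A} {A'} A⊆A' with basis A
  ... | B , (B⊆A , iB) , eB = subst (_≤ rk N A') eB (rk-≥ (⊆-trans B⊆A A⊆A') iB)

  rk-⊥ : rk N ⊥ ≡ 0
  rk-⊥ = ℕP.n≤0⇒n≡0 (subst (rk N ⊥ ≤_) (∣⊥∣≡0 n) (rk-≤-∣∣ ⊥))

  rk-≤-rank : (A : Subset n) → rk N A ≤ rank N
  rk-≤-rank A = rk-mono ⊆⊤

  indep⇒rk≡∣∣ : ∀ {A} → indep N A ≡ true → rk N A ≡ ∣ A ∣
  indep⇒rk≡∣∣ {A} iA = ℕP.≤-antisym (rk-≤-∣∣ A) (rk-≥ ⊆-refl iA)

  rk≡∣∣⇒indep : ∀ {A} → rk N A ≡ ∣ A ∣ → indep N A ≡ true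
  rk≡∣∣⇒indep {A} h with basis A
  ... | B , (B⊆A , iB) , eB =
    subst (λ Z → indep N Z ≡ true) (⊆-∣∣-≡ B A (lookup-⊆ B⊆A) (ℕP.≤-reflexive (trans (sym h) (sym eB)))) iB

  rk-∪⁅⁆-≤ : (X : Subset n) (e : Fin n) → rk N (X ∪ ⁅ e ⁆) ≤ suc (rk N X)
  rk-∪⁅⁆-≤ X e with basis (X ∪ ⁅ e ⁆)
  ... | B , (B⊆ , iB) , eB with lookup B e in Be
  ...   | true = subst (_≤ suc (rk N X)) eB (subst (_≤ suc (rk N X)) (sym (∣─⁅⁆∣ B e Be))
                   (s≤s (rk-≥ (─⁅⁆-⊆ B X e B⊆) (indep-⊆ N (p─q⊆p B ⁅ e ⁆) iB))))
  ...   | false = ℕP.≤-trans (subst (_≤ rk N X) eB (rk-≥ (⊆-∪⁅⁆-∉ B⊆ Be) iB)) (ℕP.n≤1+n _)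

  -- every independent I ⊆ Y extends to a basis of Y (fuel k bounds the missing size)
  extend-to-basis : (k : ℕ) (Y I : Subset n) → I ⊆ Y → indep N I ≡ true → rk N Y ≤ ∣ I ∣ + k →
                    ∃ λ J → I ⊆ J × J ⊆ Y × indep N J ≡ true × ∣ J ∣ ≡ rk N Y
  extend-to-basis k Y I I⊆Y iI le with ℕP.m≤n⇒m<n∨m≡n (rk-≥ I⊆Y iI)
  ... | inj₂ eq = I , ⊆-refl , I⊆Y , iI , eq
  extend-to-basis zero Y I I⊆Y iI le | inj₁ lt =
    ⊥-elim (ℕP.<-irrefl refl (ℕP.<-≤-trans lt (subst (rk N Y ≤_) (ℕP.+-identityʳ _) le)))
  extend-to-basis (suc k) Y I I⊆Y iI le | inj₁ lt with basis Y
  ... | K , (K⊆Y , iK) , eK with indep-aug N iI iK (subst (∣ I ∣ <_) (sym eK) lt)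
  ...   | x , x∈K , x∉I , iIx with extend-to-basis k Y (I ∪ ⁅ x ⁆) Ix⊆Y iIx
           (subst (rk N Y ≤_) (trans (ℕP.+-suc _ k) (cong (_+ k) (sym (∣∪⁅⁆∣ I x (∉⇒lookup x∉I))))) le)
    where
    Ix⊆Y : I ∪ ⁅ x ⁆ ⊆ Y
    Ix⊆Y = ∪-lub I⊆Y (λ y∈ → subst (_∈ Y) (sym (lookup-⁅⁆⇒≡ (∈⇒lookup y∈))) (K⊆Y x∈K))
  ...     | J , Ix⊆J , J⊆Y , iJ , eJ = J , (λ y∈ → Ix⊆J (p⊆p∪q ⁅ x ⁆ y∈)) , J⊆Y , iJ , eJ

  rank-closure-mono : {X Y : Subset n} (e : Fin n) → X ⊆ Y →
                      rk N (X ∪ ⁅ e ⁆) ≡ rk N X → rk N (Y ∪ ⁅ e ⁆) ≡ rk N Y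
  rank-closure-mono {X} {Y} e X⊆Y hX with lookup Y e in Ye
  ... | true = cong (rk N) (∪⁅⁆-absorb Y e Ye)
  ... | false with ℕP.m≤n⇒m<n∨m≡n (rk-mono (p⊆p∪q ⁅ e ⁆))
  ...   | inj₂ eq = sym eq
  ...   | inj₁ lt with basis X
  ...     | I , (I⊆X , iI) , eI with extend-to-basis (rk N Y) Y I (⊆-trans I⊆X X⊆Y) iI (ℕP.m≤n+m _ _)
  ...       | J , I⊆J , J⊆Y , iJ , eJ with basis (Y ∪ ⁅ e ⁆)
  ...         | K , (K⊆ , iK) , eK with indep-aug N iJ iK (subst₂ _<_ (sym eJ) (sym eK) lt)
  ...           | x , x∈K , x∉J , iJx with x FinP.≟ e
    -- J ∪ {e} independent contradicts e ∈ cl(X) via the basis I ⊆ J of X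
  ...             | yes refl = ⊥-elim (ℕP.<-irrefl refl (ℕP.<-≤-trans (s≤s (ℕP.≤-reflexive (sym eI)))
                       (subst (_≤ rk N X) (∣∪⁅⁆∣ I x Ix) (subst (λ z → ∣ I ∪ ⁅ x ⁆ ∣ ≤ z) hX
                         (rk-≥ (∪-mono I⊆X ⊆-refl) (indep-⊆ N (∪-mono I⊆J ⊆-refl) iJx))))))
    where
    Ix : lookup I x ≡ false
    Ix with lookup I x in q
    ... | true = ⊥-elim (true≢false (lookup-⊆ (⊆-trans I⊆X X⊆Y) x q) Ye)
    ... | false = refl
    -- J ∪ {x} with x ∈ Y independent contradicts J being a basis of Y
  ...             | no x≢e = ⊥-elim (ℕP.<-irrefl refl (ℕP.<-≤-trans (s≤s (ℕP.≤-reflexive (sym eJ)))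
                       (subst (_≤ rk N Y) (∣∪⁅⁆∣ J x (∉⇒lookup x∉J))
                         (rk-≥ (∪-lub J⊆Y (λ y∈ → subst (_∈ Y) (sym (lookup-⁅⁆⇒≡ (∈⇒lookup y∈))) x∈Y)) iJx))))
    where
    x∈Y : x ∈ Y
    x∈Y = [ lookup⇒∈ , (λ x≡e → ⊥-elim (x≢e x≡e)) ]′ (lookup-∪⁅⁆⁻ Y e x (lookup-⊆ K⊆ x (∈⇒lookup x∈K)))

module _ (I : Subset n → Bool) where

  minDep-elim : ∀ {C} → minDep I C ≡ true → I C ≡ false × (∀ D → D ⊂ C → I D ≡ true)
  minDep-elim {C} h with ∧-split {not (I C)} h
  ... | nI , minimal = not-true nI , λ D D⊂C → atD D (all-elim _ (allSubsets n) minimal (allSubsets-complete D)) D⊂C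
    where
    atD : ∀ D → (not ⌊ D ⊂? C ⌋ ∨ I D) ≡ true → D ⊂ C → I D ≡ true
    atD D q D⊂C rewrite ⌊⌋-true (D ⊂? C) D⊂C = q

  -- every dependent set contains a minimal dependent one (fuel k ≥ ∣ D ∣)
  private
    minDep-within : (k : ℕ) (D : Subset n) → ∣ D ∣ ≤ k → I D ≡ false → ∃ λ C → C ⊆ D × minDep I C ≡ true
    minDep-within k D le iD with all (λ D' → not ⌊ D' ⊂? D ⌋ ∨ I D') (allSubsets n) in minimal
    ... | true = D , ⊆-refl , ∧-intro (not-false iD) minimal
    ... | false with all-false _ (allSubsets n) minimal
    ...   | D' , q with D' ⊂? D | I D' in iD'
    ...     | yes D'⊂D | false with k
    ...       | zero = ⊥-elim (ℕP.<-irrefl refl (ℕP.<-≤-trans (p⊂q⇒∣p∣<∣q∣ D'⊂D) (ℕP.≤-trans le z≤n)))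
    ...       | suc k' with minDep-within k' D' (ℕP.≤-pred (ℕP.≤-trans (p⊂q⇒∣p∣<∣q∣ D'⊂D) le)) iD'
    ...         | C , C⊆D' , mC = C , ⊆-trans C⊆D' (proj₁ D'⊂D) , mC
    minDep-within k D le iD | false | D' , () | yes D'⊂D | true
    minDep-within k D le iD | false | D' , () | no _ | _

  minDep-exists : (D : Subset n) → I D ≡ false → ∃ λ C → C ⊆ D × minDep I C ≡ true
  minDep-exists D = minDep-within ∣ D ∣ D ℕP.≤-refl

inClosure : (Subset n → ℕ) → Subset n → Fin n → Bool
inClosure ρ X e = ⌊ ρ (X ∪ ⁅ e ⁆) ℕ.≟ ρ X ⌋

module Circuits {n : ℕ} (N : Matroid n) where
  open Rank N

  circuit-closure : ∀ {C} e → circuit N C ≡ true → lookup C e ≡ true →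
                    rk N ((C ─ ⁅ e ⁆) ∪ ⁅ e ⁆) ≡ rk N (C ─ ⁅ e ⁆)
  circuit-closure {C} e cC Ce with minDep-elim (indep N) cC
  ... | depC , minimal = ℕP.≤-antisym rk≤ (rk-mono (p⊆p∪q ⁅ e ⁆))
    where
    rest-indep : rk N (C ─ ⁅ e ⁆) ≡ ∣ C ─ ⁅ e ⁆ ∣
    rest-indep = indep⇒rk≡∣∣ (minimal (C ─ ⁅ e ⁆) (x∈p⇒p-x⊂p (lookup⇒∈ Ce)))
    rk<∣C∣ : rk N C < ∣ C ∣
    rk<∣C∣ with ℕP.m≤n⇒m<n∨m≡n (rk-≤-∣∣ C)
    ... | inj₁ lt = lt
    ... | inj₂ eq = ⊥-elim (true≢false (rk≡∣∣⇒indep eq) depC)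
    rk≤ : rk N ((C ─ ⁅ e ⁆) ∪ ⁅ e ⁆) ≤ rk N (C ─ ⁅ e ⁆)
    rk≤ rewrite ─⁅⁆-∪⁅⁆ C e Ce | rest-indep = ℕP.≤-pred (subst (rk N C <_) (∣─⁅⁆∣ C e Ce) rk<∣C∣)

  closure-circuit : ∀ {S} e → lookup S e ≡ false → rk N (S ∪ ⁅ e ⁆) ≡ rk N S →
                    ∃ λ C → circuit N C ≡ true × C ⊆ S ∪ ⁅ e ⁆ × lookup C e ≡ true
  closure-circuit {S} e Se h with basis S
  ... | I , (I⊆S , iI) , eI with indep N (I ∪ ⁅ e ⁆) in iIe
  ...   | true = ⊥-elim (ℕP.<-irrefl refl (ℕP.<-≤-trans (s≤s (ℕP.≤-reflexive (sym eI)))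
              (subst (_≤ rk N S) (∣∪⁅⁆∣ I e Ie) (subst (∣ I ∪ ⁅ e ⁆ ∣ ≤_) h (rk-≥ (∪-mono I⊆S ⊆-refl) iIe)))))
    where
    Ie : lookup I e ≡ false
    Ie with lookup I e in q
    ... | true = ⊥-elim (true≢false (lookup-⊆ I⊆S e q) Se)
    ... | false = refl
  ...   | false with minDep-exists (indep N) (I ∪ ⁅ e ⁆) iIe
  ...     | C , C⊆ , mC with lookup C e in Ce
  ...       | true = C , mC , ⊆-trans C⊆ (∪-mono I⊆S ⊆-refl) , Ce
  ...       | false = ⊥-elim (true≢false (indep-⊆ N (⊆-∪⁅⁆-∉ C⊆ Ce) iI) (proj₁ (minDep-elim (indep N) mC)))

perspective-closure : {n : ℕ} (M M' : Matroid n) → Perspective M M' → ∀ X e →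
                      rk M (X ∪ ⁅ e ⁆) ≡ rk M X → rk M' (X ∪ ⁅ e ⁆) ≡ rk M' X
perspective-closure M M' P X e h with lookup X e in Xe
... | true = cong (rk M') (∪⁅⁆-absorb X e Xe)
... | false with Circuits.closure-circuit M e Xe h
...   | C , cC , C⊆ , Ce with P C cC e (lookup⇒∈ Ce)
...     | C' , cC' , C'⊆C , e∈C' =
  Rank.rank-closure-mono M' e (─⁅⁆-⊆ C' X e (⊆-trans C'⊆C C⊆)) (Circuits.circuit-closure M' e cC' (∈⇒lookup e∈C'))

Gt : Fin n → Subset n
Gt e = tabulate (λ i → toℕ e <ᵇ toℕ i)

Lt : ℕ → Subset n
Lt k = tabulate (λ i → toℕ i <ᵇ k)

lookup-Gt : (e i : Fin n) → lookup (Gt e) i ≡ (toℕ e <ᵇ toℕ i)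
lookup-Gt e i = lookup∘tabulate _ i

lookup-Lt : (k : ℕ) (i : Fin n) → lookup (Lt {n} k) i ≡ (toℕ i <ᵇ k)
lookup-Lt k i = lookup∘tabulate _ i

isMinOf-elim : ∀ {e : Fin n} {C} → isMinOf e C ≡ true →
               lookup C e ≡ true × (∀ f → lookup C f ≡ true → toℕ e ≤ toℕ f)
isMinOf-elim {n} {e} {C} h with ∧-split {⌊ e ∈? C ⌋} h
... | e∈C , below = trans (sym (lookup∈? e C)) e∈C , λ f Cf → atF f Cf (all-elim _ (L.allFin n) below (∈-allFin f))
  where
  atF : ∀ f → lookup C f ≡ true → (not ⌊ f ∈? C ⌋ ∨ ⌊ toℕ e ℕ.≤? toℕ f ⌋) ≡ true → toℕ e ≤ toℕ f
  atF f Cf q rewrite lookup∈? f C | Cf = ⌊⌋-elim (toℕ e ℕ.≤? toℕ f) q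

isMinOf-intro : ∀ {e : Fin n} {C} → lookup C e ≡ true → (∀ f → lookup C f ≡ true → toℕ e ≤ toℕ f) →
                isMinOf e C ≡ true
isMinOf-intro {n} {e} {C} Ce h = ∧-intro (trans (lookup∈? e C) Ce) (all-intro _ (L.allFin n) atF)
  where
  atF : ∀ f → (not ⌊ f ∈? C ⌋ ∨ ⌊ toℕ e ℕ.≤? toℕ f ⌋) ≡ true
  atF f rewrite lookup∈? f C with lookup C f in Cf
  ... | true = ⌊⌋-true (toℕ e ℕ.≤? toℕ f) (h f Cf)
  ... | false = refl

module Activities {n : ℕ} (N : Matroid n) where
  open Rank N
  open Circuits N

  externallyActive : Subset n → Fin n → Bool
  externallyActive A e = any (λ C → circuit N C ∧ ⌊ C ⊆? (A ∪ ⁅ e ⁆) ⌋ ∧ isMinOf e C) (allSubsets n)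

  internallyActive : Subset n → Fin n → Bool
  internallyActive A e = any (λ C → cocircuit N C ∧ ⌊ C ⊆? (∁ A ∪ ⁅ e ⁆) ⌋ ∧ isMinOf e C) (allSubsets n)

  -- the rest of a circuit with least element e lies in A after e
  externallyActive⇒closure : (A : Subset n) (e : Fin n) →
                             externallyActive A e ≡ true → inClosure (rk N) (A ∩ Gt e) e ≡ true
  externallyActive⇒closure A e h with any-elim _ (allSubsets n) h
  ... | C , q with ∧-split {circuit N C} q
  ...   | cC , q' with ∧-split {⌊ C ⊆? (A ∪ ⁅ e ⁆) ⌋} q'
  ...     | C⊆ , isMin with isMinOf-elim {e = e} {C} isMin
  ...       | Ce , least = ⌊⌋-true (_ ℕ.≟ _) (rank-closure-mono e C-e⊆ (circuit-closure e cC Ce))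
    where
    C-e⊆ : C ─ ⁅ e ⁆ ⊆ A ∩ Gt e
    C-e⊆ = ⊆-byLookup λ i hi → let (Ci , i≢e) = lookup-─⁅⁆⁻ C e i hi in
      lookup-∩⁺ A (Gt e) i
        ([ (λ Ai → Ai) , (λ i≡e → ⊥-elim (i≢e i≡e)) ]′
           (lookup-∪⁅⁆⁻ A e i (lookup-⊆ (⌊⌋-elim (C ⊆? (A ∪ ⁅ e ⁆)) C⊆) i Ci)))
        (trans (lookup-Gt e i) (<⇒<ᵇ _ _ (ℕP.≤∧≢⇒< (least i Ci) (i≢e ∘ sym ∘ FinP.toℕ-injective))))

  -- a circuit closed by e inside (A after e) ∪ {e} has least element e
  closure⇒externallyActive : (A : Subset n) (e : Fin n) → lookup A e ≡ false →
                             inClosure (rk N) (A ∩ Gt e) e ≡ true → externallyActive A e ≡ true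
  closure⇒externallyActive A e Ae h with closure-circuit {A ∩ Gt e} e Se (⌊⌋-elim (_ ℕ.≟ _) h)
    where
    Se : lookup (A ∩ Gt e) e ≡ false
    Se = trans (lookup-∩ A (Gt e) e) (cong (_∧ lookup (Gt e) e) Ae)
  ... | C , cC , C⊆ , Ce = any-intro _ (allSubsets n) (allSubsets-complete C)
        (∧-intro cC (∧-intro (⌊⌋-true (C ⊆? (A ∪ ⁅ e ⁆)) (⊆-trans C⊆ (∪-mono S⊆A ⊆-refl)))
                             (isMinOf-intro Ce least)))
    where
    S⊆A : A ∩ Gt e ⊆ A
    S⊆A = ⊆-byLookup λ i hi → proj₁ (lookup-∩⁻ A (Gt e) i hi)
    least : ∀ f → lookup C f ≡ true → toℕ e ≤ toℕ f
    least f Cf with lookup-∪⁅⁆⁻ (A ∩ Gt e) e f (lookup-⊆ C⊆ f Cf)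
    ... | inj₂ refl = ℕP.≤-refl
    ... | inj₁ Sf = ℕP.<⇒≤ (<ᵇ⇒< _ _ (trans (sym (lookup-Gt e f)) (proj₂ (lookup-∩⁻ A (Gt e) f Sf))))

  externallyActive-closure : (A : Subset n) (e : Fin n) → lookup A e ≡ false →
                             externallyActive A e ≡ inClosure (rk N) (A ∩ Gt e) e
  externallyActive-closure A e Ae = bool-ext (externallyActive⇒closure A e) (closure⇒externallyActive A e Ae)

  closed⇒spanning : (Z : Subset n) → (∀ f → rk N (Z ∪ ⁅ f ⁆) ≡ rk N Z) → rank N ≡ rk N Z
  closed⇒spanning Z closed = ℕP.≤-antisym (subst (rank N ≤_) (absorb-all (L.allFin n)) (rk-mono ⊤⊆)) (rk-≤-rank Z)
    where
    setOf : List (Fin n) → Subset n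
    setOf [] = ⊥
    setOf (f ∷ fs) = setOf fs ∪ ⁅ f ⁆
    ⊤⊆ : ⊤ ⊆ Z ∪ setOf (L.allFin n)
    ⊤⊆ = ⊆-byLookup λ i _ → lookup-∪⁺ʳ Z (setOf (L.allFin n)) i (member (L.allFin n) (∈-allFin i))
      where
      member : ∀ fs {i} → i LM.∈ fs → lookup (setOf fs) i ≡ true
      member (f ∷ fs) (here refl) = lookup-∪⁺ʳ (setOf fs) ⁅ f ⁆ f (lookup-⁅⁆-self f)
      member (f ∷ fs) {i} (there m) = lookup-∪⁺ˡ (setOf fs) ⁅ f ⁆ i (member fs m)
    absorb-all : ∀ fs → rk N (Z ∪ setOf fs) ≡ rk N Z
    absorb-all [] = cong (rk N) (∪-identityʳ Z)
    absorb-all (f ∷ fs) = trans (cong (rk N) (sym (∪-assoc Z (setOf fs) ⁅ f ⁆)))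
                                (trans (rank-closure-mono f (p⊆p∪q (setOf fs)) (closed f)) (absorb-all fs))

  -- Greedy completion: a set X avoiding e in its closure grows to a maximal such
  -- set H, i.e. H ∪ {e} is spanning while e ∉ cl(H).
  private module Greedy (e : Fin n) where

    Avoids : Subset n → Set
    Avoids H = ¬ rk N (H ∪ ⁅ e ⁆) ≡ rk N H

    Settled : Subset n → Fin n → Set
    Settled H f = lookup H f ≡ true ⊎ rk N ((H ∪ ⁅ f ⁆) ∪ ⁅ e ⁆) ≡ rk N (H ∪ ⁅ f ⁆)

    step : Subset n → Fin n → Subset n
    step H f = if inClosure (rk N) (H ∪ ⁅ f ⁆) e then H else H ∪ ⁅ f ⁆

    greedy : List (Fin n) → Subset n → Subset n
    greedy [] H = H
    greedy (f ∷ fs) H = greedy fs (step H f)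

    step-avoids : ∀ H f → Avoids H → Avoids (step H f)
    step-avoids H f h with inClosure (rk N) (H ∪ ⁅ f ⁆) e in c
    ... | true = h
    ... | false = ⌊⌋-elim' (_ ℕ.≟ _) c

    step-⊇ : ∀ H f → H ⊆ step H f
    step-⊇ H f with inClosure (rk N) (H ∪ ⁅ f ⁆) e
    ... | true = ⊆-refl
    ... | false = p⊆p∪q ⁅ f ⁆

    step-settles : ∀ H f → Settled (step H f) f
    step-settles H f with inClosure (rk N) (H ∪ ⁅ f ⁆) e in c
    ... | true = inj₂ (⌊⌋-elim (_ ℕ.≟ _) c)
    ... | false = inj₁ (lookup-∪⁺ʳ H ⁅ f ⁆ f (lookup-⁅⁆-self f))

    settled-mono : ∀ {H H'} f → H ⊆ H' → Settled H f → Settled H' f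
    settled-mono f s (inj₁ p) = inj₁ (lookup-⊆ s f p)
    settled-mono f s (inj₂ p) = inj₂ (rank-closure-mono e (∪-mono s ⊆-refl) p)

    greedy-⊇ : ∀ fs H → H ⊆ greedy fs H
    greedy-⊇ [] H = ⊆-refl
    greedy-⊇ (f ∷ fs) H = ⊆-trans (step-⊇ H f) (greedy-⊇ fs (step H f))

    greedy-avoids : ∀ fs H → Avoids H → Avoids (greedy fs H)
    greedy-avoids [] H h = h
    greedy-avoids (f ∷ fs) H h = greedy-avoids fs (step H f) (step-avoids H f h)

    greedy-settles : ∀ fs H f → f LM.∈ fs → Settled (greedy fs H) f
    greedy-settles (f ∷ fs) H .f (here refl) = settled-mono f (greedy-⊇ fs (step H f)) (step-settles H f)
    greedy-settles (g ∷ fs) H f (there m) = greedy-settles fs (step H g) f m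

    settled⇒closure : ∀ H f → Avoids H → Settled H f → rk N ((H ∪ ⁅ e ⁆) ∪ ⁅ f ⁆) ≡ rk N (H ∪ ⁅ e ⁆)
    settled⇒closure H f avoids (inj₁ Hf) = cong (rk N) (∪⁅⁆-absorb (H ∪ ⁅ e ⁆) f (lookup-∪⁺ˡ H ⁅ e ⁆ f Hf))
    settled⇒closure H f avoids (inj₂ p) = ℕP.≤-antisym rk≤ (rk-mono (p⊆p∪q ⁅ f ⁆))
      where
      He : rk N (H ∪ ⁅ e ⁆) ≡ suc (rk N H)
      He = ℕP.≤-antisym (rk-∪⁅⁆-≤ H e) (ℕP.≤∧≢⇒< (rk-mono (p⊆p∪q ⁅ e ⁆)) (avoids ∘ sym))
      rk≤ : rk N ((H ∪ ⁅ e ⁆) ∪ ⁅ f ⁆) ≤ rk N (H ∪ ⁅ e ⁆)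
      rk≤ rewrite ∪-swap H ⁅ e ⁆ ⁅ f ⁆ | p | He = rk-∪⁅⁆-≤ H f

  maximal-avoiding : (X : Subset n) (e : Fin n) → ¬ rk N (X ∪ ⁅ e ⁆) ≡ rk N X →
                     ∃ λ H → X ⊆ H × ¬ rk N (H ∪ ⁅ e ⁆) ≡ rk N H × rank N ≡ rk N (H ∪ ⁅ e ⁆)
  maximal-avoiding X e avoids = H , greedy-⊇ (L.allFin n) X , avoidsH ,
    closed⇒spanning (H ∪ ⁅ e ⁆) λ f → settled⇒closure H f avoidsH (greedy-settles (L.allFin n) X f (∈-allFin f))
    where
    open Greedy e
    H = greedy (L.allFin n) X
    avoidsH = greedy-avoids (L.allFin n) X avoids

  -- Write X = (A after e) ∪ (everything before e).  A cocircuit C ⊆ (E∖A) ∪ {e}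
  -- with least element e misses X; since E∖(C∖{e})
  -- is spanning, e ∈ cl(X) would make the complement of C spanning.
  internallyActive⇒¬closure : (A : Subset n) (e : Fin n) →
    internallyActive A e ≡ true → not (inClosure (rk N) ((A ∩ Gt e) ∪ Lt (toℕ e)) e) ≡ true
  internallyActive⇒¬closure A e h with any-elim _ (allSubsets n) h
  ... | C , q with ∧-split {cocircuit N C} q
  ...   | cC , q' with ∧-split {⌊ C ⊆? (∁ A ∪ ⁅ e ⁆) ⌋} q'
  ...     | C⊆ , isMin with isMinOf-elim {e = e} {C} isMin | minDep-elim (dualIndep N) cC
  ...       | Ce , least | dependent , minimal = not-false (⌊⌋-false (_ ℕ.≟ _) λ eq →
                ⌊⌋-elim' (_ ℕ.≟ _) dependent
                  (trans (sym (rank-closure-mono e X⊆∁C eq)) (trans (cong (rk N) (sym (∁-─⁅⁆ C e))) C-e-coindep)))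
    where
    X = (A ∩ Gt e) ∪ Lt (toℕ e)
    C-e-coindep : rk N (∁ (C ─ ⁅ e ⁆)) ≡ rank N
    C-e-coindep = ⌊⌋-elim (_ ℕ.≟ _) (minimal (C ─ ⁅ e ⁆) (x∈p⇒p-x⊂p (lookup⇒∈ Ce)))
    X∩C-empty : ∀ i → lookup X i ≡ true → lookup C i ≡ false
    X∩C-empty i Xi with lookup C i in Ci
    ... | false = refl
    ... | true with lookup-∪⁻ (A ∩ Gt e) (Lt (toℕ e)) i Xi
    ...   | inj₂ i<e = ⊥-elim (ℕP.<-irrefl refl
              (ℕP.<-≤-trans (<ᵇ⇒< _ _ (trans (sym (lookup-Lt (toℕ e) i)) i<e)) (least i Ci)))
    ...   | inj₁ AGi with lookup-∩⁻ A (Gt e) i AGi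
    ...     | Ai , e<i with lookup-∪⁅⁆⁻ (∁ A) e i (lookup-⊆ (⌊⌋-elim (C ⊆? (∁ A ∪ ⁅ e ⁆)) C⊆) i Ci)
    ...       | inj₁ ∁Ai = ⊥-elim (true≢false Ai (not-true (trans (sym (lookup-∁ A i)) ∁Ai)))
    ...       | inj₂ refl = ⊥-elim (ℕP.<-irrefl refl (<ᵇ⇒< (toℕ i) (toℕ i) (trans (sym (lookup-Gt i i)) e<i)))
    X⊆∁C : X ⊆ ∁ C
    X⊆∁C = ⊆-byLookup λ i Xi → trans (lookup-∁ C i) (not-false (X∩C-empty i Xi))

  -- Conversely, extend X to H maximal with e ∉ cl(H); a cocircuit inside E∖H
  -- must contain e and, avoiding X, has e as least element and misses A∖{e}.
  ¬closure⇒internallyActive : (A : Subset n) (e : Fin n) →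
    not (inClosure (rk N) ((A ∩ Gt e) ∪ Lt (toℕ e)) e) ≡ true → internallyActive A e ≡ true
  ¬closure⇒internallyActive A e h with maximal-avoiding ((A ∩ Gt e) ∪ Lt (toℕ e)) e (⌊⌋-elim' (_ ℕ.≟ _) (not-true h))
  ... | H , X⊆H , avoidsH , spanning with minDep-exists (dualIndep N) (∁ H) ∁H-codependent
    where
    ∁H-codependent : dualIndep N (∁ H) ≡ false
    ∁H-codependent = ⌊⌋-false (_ ℕ.≟ _) λ eq →
      avoidsH (trans (sym spanning) (trans (sym eq) (cong (rk N) (∁-involutive H))))
  ... | C , C⊆∁H , cC =
    any-intro _ (allSubsets n) (allSubsets-complete C)
      (∧-intro cC (∧-intro (⌊⌋-true (C ⊆? (∁ A ∪ ⁅ e ⁆)) C⊆) (isMinOf-intro Ce least)))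
    where
    X = (A ∩ Gt e) ∪ Lt (toℕ e)
    ∉H : ∀ i → lookup C i ≡ true → lookup H i ≡ false
    ∉H i Ci = not-true (trans (sym (lookup-∁ H i)) (lookup-⊆ C⊆∁H i Ci))
    ∉X : ∀ i → lookup C i ≡ true → lookup X i ≡ false
    ∉X i Ci with lookup X i in Xi
    ... | false = refl
    ... | true = ⊥-elim (true≢false (lookup-⊆ X⊆H i Xi) (∉H i Ci))
    ∨-false : ∀ {a b : Bool} → (a ∨ b) ≡ false → a ≡ false × b ≡ false
    ∨-false {false} {false} _ = refl , refl
    least : ∀ f → lookup C f ≡ true → toℕ e ≤ toℕ f
    least f Cf = <ᵇ-false⇒≥ (toℕ f) (toℕ e) (trans (sym (lookup-Lt (toℕ e) f))
      (proj₂ (∨-false (trans (sym (lookup-∪ (A ∩ Gt e) (Lt (toℕ e)) f)) (∉X f Cf)))))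
    -- e ∉ C would put the spanning set H ∪ {e} inside E∖C
    Ce : lookup C e ≡ true
    Ce with lookup C e in ce
    ... | true = refl
    ... | false = ⊥-elim (true≢false
            (⌊⌋-true (_ ℕ.≟ _) (ℕP.≤-antisym (rk-≤-rank (∁ C)) (subst (_≤ rk N (∁ C)) (sym spanning) (rk-mono He⊆∁C))))
            (proj₁ (minDep-elim (dualIndep N) cC)))
      where
      He⊆∁C : H ∪ ⁅ e ⁆ ⊆ ∁ C
      He⊆∁C = ⊆-byLookup λ i hi → trans (lookup-∁ C i) (not-false (∉C i hi))
        where
        ∉C : ∀ i → lookup (H ∪ ⁅ e ⁆) i ≡ true → lookup C i ≡ false
        ∉C i hi with lookup C i in Ci
        ... | false = refl
        ... | true with lookup-∪⁅⁆⁻ H e i hi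
        ...   | inj₁ Hi = ⊥-elim (true≢false Hi (∉H i Ci))
        ...   | inj₂ refl = ⊥-elim (true≢false Ci ce)
    -- elements of C after e are outside A, since A ∩ Gt e ⊆ X
    C⊆ : C ⊆ ∁ A ∪ ⁅ e ⁆
    C⊆ = ⊆-byLookup λ i Ci → atI i Ci
      where
      atI : ∀ i → lookup C i ≡ true → lookup (∁ A ∪ ⁅ e ⁆) i ≡ true
      atI i Ci with i FinP.≟ e
      ... | yes refl = lookup-∪⁺ʳ (∁ A) ⁅ i ⁆ i (lookup-⁅⁆-self i)
      ... | no i≢e = lookup-∪⁺ˡ (∁ A) ⁅ e ⁆ i (trans (lookup-∁ A i) (not-false (¬Ai (lookup A i) refl)))
        where
        e<i : (toℕ e <ᵇ toℕ i) ≡ true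
        e<i = <⇒<ᵇ _ _ (ℕP.≤∧≢⇒< (least i Ci) (i≢e ∘ sym ∘ FinP.toℕ-injective))
        ¬Ai : ∀ b → lookup A i ≡ b → b ≡ false
        ¬Ai false _ = refl
        ¬Ai true Ai = ⊥-elim (true≢false
          (lookup-∪⁺ˡ (A ∩ Gt e) (Lt (toℕ e)) i (lookup-∩⁺ A (Gt e) i Ai (trans (lookup-Gt e i) e<i))) (∉X i Ci))

  internallyActive-closure : (A : Subset n) (e : Fin n) →
    internallyActive A e ≡ not (inClosure (rk N) ((A ∩ Gt e) ∪ Lt (toℕ e)) e)
  internallyActive-closure A e = bool-ext (internallyActive⇒¬closure A e) (¬closure⇒internallyActive A e)

-- Every set identity about Lt, Gt and ⁅ e ⁆
-- below is proved pointwise by splitting on whether i is before, at or after e;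
-- the view fixes all Boolean comparisons that occur at once.

data Position {n : ℕ} (i e : Fin n) : Bool → Bool → Bool → Bool → Set where
  before : Position i e true true false false
  at     : i ≡ e → Position i e false true false true
  after  : Position i e false false true false

position : (i e : Fin n) →
           Position i e (toℕ i <ᵇ toℕ e) (toℕ i <ᵇ suc (toℕ e)) (toℕ e <ᵇ toℕ i) (toℕ i ≡ᵇ toℕ e)
position i e with ℕP.<-cmp (toℕ i) (toℕ e)
... | tri< i<e i≢e _
  rewrite <⇒<ᵇ _ _ i<e | <⇒<ᵇ _ _ (ℕP.m<n⇒m<1+n i<e) | ≮⇒<ᵇ _ _ (ℕP.<⇒≯ i<e) | ≢⇒≡ᵇ _ _ i≢e = before
... | tri> _ i≢e e<i
  rewrite ≮⇒<ᵇ _ _ (ℕP.<⇒≯ e<i) | ≮⇒<ᵇ _ _ (ℕP.<⇒≱ e<i ∘ ℕP.≤-pred) | <⇒<ᵇ _ _ e<i | ≢⇒≡ᵇ _ _ i≢e = after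
... | tri≈ _ i≡e _ with FinP.toℕ-injective i≡e
...   | refl rewrite <ᵇ-irrefl (toℕ i) | <ᵇ-suc (toℕ i) | ≡ᵇ-refl (toℕ i) = at refl

module AroundPosition (B : Subset n) (e : Fin n) where
  private k = toℕ e

  Lt-∪-absent : lookup B e ≡ false → Lt k ∪ B ≡ (B ∩ Gt e) ∪ Lt k
  Lt-∪-absent Be = subset-ext pointwise
    where
    pointwise : ∀ i → lookup (Lt k ∪ B) i ≡ lookup ((B ∩ Gt e) ∪ Lt k) i
    pointwise i rewrite lookup-∪ (Lt k) B i | lookup-∪ (B ∩ Gt e) (Lt k) i | lookup-∩ B (Gt e) i | lookup-Lt k i | lookup-Gt e i
      with toℕ i <ᵇ k | toℕ i <ᵇ suc k | k <ᵇ toℕ i | toℕ i ≡ᵇ k | position i e | lookup B i in Bi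
    ... | _ | _ | _ | _ | before | true = refl
    ... | _ | _ | _ | _ | before | false = refl
    ... | _ | _ | _ | _ | after | true = refl
    ... | _ | _ | _ | _ | after | false = refl
    ... | _ | _ | _ | _ | at refl | true = ⊥-elim (true≢false Bi Be)
    ... | _ | _ | _ | _ | at refl | false = refl

  Lt-suc-∪-absent : lookup B e ≡ false → Lt (suc k) ∪ B ≡ ((B ∩ Gt e) ∪ Lt k) ∪ ⁅ e ⁆
  Lt-suc-∪-absent Be = subset-ext pointwise
    where
    pointwise : ∀ i → lookup (Lt (suc k) ∪ B) i ≡ lookup (((B ∩ Gt e) ∪ Lt k) ∪ ⁅ e ⁆) i
    pointwise i rewrite lookup-∪ (Lt (suc k)) B i | lookup-∪ ((B ∩ Gt e) ∪ Lt k) ⁅ e ⁆ i | lookup-∪ (B ∩ Gt e) (Lt k) i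
      | lookup-∩ B (Gt e) i | lookup-Lt k i | lookup-Lt (suc k) i | lookup-Gt e i | lookup-⁅⁆ e i
      with toℕ i <ᵇ k | toℕ i <ᵇ suc k | k <ᵇ toℕ i | toℕ i ≡ᵇ k | position i e | lookup B i in Bi
    ... | _ | _ | _ | _ | before | true = refl
    ... | _ | _ | _ | _ | before | false = refl
    ... | _ | _ | _ | _ | after | true = refl
    ... | _ | _ | _ | _ | after | false = refl
    ... | _ | _ | _ | _ | at refl | true = ⊥-elim (true≢false Bi Be)
    ... | _ | _ | _ | _ | at refl | false = refl

  Lt-suc-∪-present : lookup B e ≡ true → Lt (suc k) ∪ B ≡ Lt k ∪ B
  Lt-suc-∪-present Be = subset-ext pointwise
    where
    pointwise : ∀ i → lookup (Lt (suc k) ∪ B) i ≡ lookup (Lt k ∪ B) i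
    pointwise i rewrite lookup-∪ (Lt (suc k)) B i | lookup-∪ (Lt k) B i | lookup-Lt k i | lookup-Lt (suc k) i
      with toℕ i <ᵇ k | toℕ i <ᵇ suc k | k <ᵇ toℕ i | toℕ i ≡ᵇ k | position i e | lookup B i in Bi
    ... | _ | _ | _ | _ | before | true = refl
    ... | _ | _ | _ | _ | before | false = refl
    ... | _ | _ | _ | _ | after | true = refl
    ... | _ | _ | _ | _ | after | false = refl
    ... | _ | _ | _ | _ | at refl | true = refl
    ... | _ | _ | _ | _ | at refl | false = ⊥-elim (true≢false Be Bi)

  ∩-Lt-suc-absent : lookup B e ≡ false → B ∩ Lt (suc k) ≡ B ∩ Lt k
  ∩-Lt-suc-absent Be = subset-ext pointwise
    where
    pointwise : ∀ i → lookup (B ∩ Lt (suc k)) i ≡ lookup (B ∩ Lt k) i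
    pointwise i rewrite lookup-∩ B (Lt (suc k)) i | lookup-∩ B (Lt k) i | lookup-Lt k i | lookup-Lt (suc k) i
      with toℕ i <ᵇ k | toℕ i <ᵇ suc k | k <ᵇ toℕ i | toℕ i ≡ᵇ k | position i e | lookup B i in Bi
    ... | _ | _ | _ | _ | before | true = refl
    ... | _ | _ | _ | _ | before | false = refl
    ... | _ | _ | _ | _ | after | true = refl
    ... | _ | _ | _ | _ | after | false = refl
    ... | _ | _ | _ | _ | at refl | true = ⊥-elim (true≢false Bi Be)
    ... | _ | _ | _ | _ | at refl | false = refl

  ∩-Lt-suc-present : lookup B e ≡ true → B ∩ Lt (suc k) ≡ (B ∩ Lt k) ∪ ⁅ e ⁆
  ∩-Lt-suc-present Be = subset-ext pointwise
    where
    pointwise : ∀ i → lookup (B ∩ Lt (suc k)) i ≡ lookup ((B ∩ Lt k) ∪ ⁅ e ⁆) i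
    pointwise i rewrite lookup-∩ B (Lt (suc k)) i | lookup-∪ (B ∩ Lt k) ⁅ e ⁆ i | lookup-∩ B (Lt k) i
      | lookup-Lt k i | lookup-Lt (suc k) i | lookup-⁅⁆ e i
      with toℕ i <ᵇ k | toℕ i <ᵇ suc k | k <ᵇ toℕ i | toℕ i ≡ᵇ k | position i e | lookup B i in Bi
    ... | _ | _ | _ | _ | before | true = refl
    ... | _ | _ | _ | _ | before | false = refl
    ... | _ | _ | _ | _ | after | true = refl
    ... | _ | _ | _ | _ | after | false = refl
    ... | _ | _ | _ | _ | at refl | true = refl
    ... | _ | _ | _ | _ | at refl | false = ⊥-elim (true≢false Be Bi)

  e∉∩Lt : lookup (B ∩ Lt k) e ≡ false
  e∉∩Lt = trans (lookup-∩ B (Lt k) e) (trans (cong (lookup B e ∧_) (trans (lookup-Lt k e) (<ᵇ-irrefl k))) (𝔹P.∧-zeroʳ _))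

  ─Lt-suc : B ─ Lt (suc k) ≡ B ∩ Gt e
  ─Lt-suc = subset-ext pointwise
    where
    pointwise : ∀ i → lookup (B ─ Lt (suc k)) i ≡ lookup (B ∩ Gt e) i
    pointwise i rewrite lookup-─ B (Lt (suc k)) i | lookup-∩ B (Gt e) i | lookup-Lt (suc k) i | lookup-Gt e i
      with toℕ i <ᵇ k | toℕ i <ᵇ suc k | k <ᵇ toℕ i | toℕ i ≡ᵇ k | position i e | lookup B i
    ... | _ | _ | _ | _ | before | true = refl
    ... | _ | _ | _ | _ | before | false = refl
    ... | _ | _ | _ | _ | after | true = refl
    ... | _ | _ | _ | _ | after | false = refl
    ... | _ | _ | _ | _ | at refl | true = refl
    ... | _ | _ | _ | _ | at refl | false = refl

  ─Lt-present : lookup B e ≡ true → B ─ Lt k ≡ (B ∩ Gt e) ∪ ⁅ e ⁆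
  ─Lt-present Be = subset-ext pointwise
    where
    pointwise : ∀ i → lookup (B ─ Lt k) i ≡ lookup ((B ∩ Gt e) ∪ ⁅ e ⁆) i
    pointwise i rewrite lookup-─ B (Lt k) i | lookup-∪ (B ∩ Gt e) ⁅ e ⁆ i | lookup-∩ B (Gt e) i
      | lookup-Lt k i | lookup-Gt e i | lookup-⁅⁆ e i
      with toℕ i <ᵇ k | toℕ i <ᵇ suc k | k <ᵇ toℕ i | toℕ i ≡ᵇ k | position i e | lookup B i in Bi
    ... | _ | _ | _ | _ | before | true = refl
    ... | _ | _ | _ | _ | before | false = refl
    ... | _ | _ | _ | _ | after | true = refl
    ... | _ | _ | _ | _ | after | false = refl
    ... | _ | _ | _ | _ | at refl | true = refl
    ... | _ | _ | _ | _ | at refl | false = ⊥-elim (true≢false Be Bi)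

  ─Lt-absent : lookup B e ≡ false → B ─ Lt k ≡ B ∩ Gt e
  ─Lt-absent Be = subset-ext pointwise
    where
    pointwise : ∀ i → lookup (B ─ Lt k) i ≡ lookup (B ∩ Gt e) i
    pointwise i rewrite lookup-─ B (Lt k) i | lookup-∩ B (Gt e) i | lookup-Lt k i | lookup-Gt e i
      with toℕ i <ᵇ k | toℕ i <ᵇ suc k | k <ᵇ toℕ i | toℕ i ≡ᵇ k | position i e | lookup B i in Bi
    ... | _ | _ | _ | _ | before | true = refl
    ... | _ | _ | _ | _ | before | false = refl
    ... | _ | _ | _ | _ | after | true = refl
    ... | _ | _ | _ | _ | after | false = refl
    ... | _ | _ | _ | _ | at refl | true = ⊥-elim (true≢false Bi Be)
    ... | _ | _ | _ | _ | at refl | false = refl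

  ─Lt-suc-absent : lookup B e ≡ false → B ─ Lt (suc k) ≡ B ─ Lt k
  ─Lt-suc-absent Be = trans ─Lt-suc (sym (─Lt-absent Be))

  ∪⁅⁆-∩-Lt : (B ∪ ⁅ e ⁆) ∩ Lt k ≡ B ∩ Lt k
  ∪⁅⁆-∩-Lt = subset-ext pointwise
    where
    pointwise : ∀ i → lookup ((B ∪ ⁅ e ⁆) ∩ Lt k) i ≡ lookup (B ∩ Lt k) i
    pointwise i rewrite lookup-∩ (B ∪ ⁅ e ⁆) (Lt k) i | lookup-∩ B (Lt k) i | lookup-∪ B ⁅ e ⁆ i | lookup-Lt k i | lookup-⁅⁆ e i
      with toℕ i <ᵇ k | toℕ i <ᵇ suc k | k <ᵇ toℕ i | toℕ i ≡ᵇ k | position i e | lookup B i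
    ... | _ | _ | _ | _ | before | true = refl
    ... | _ | _ | _ | _ | before | false = refl
    ... | _ | _ | _ | _ | after | true = refl
    ... | _ | _ | _ | _ | after | false = refl
    ... | _ | _ | _ | _ | at refl | true = refl
    ... | _ | _ | _ | _ | at refl | false = refl

  ∪⁅⁆-─-Lt : (B ∪ ⁅ e ⁆) ─ Lt k ≡ (B ─ Lt k) ∪ ⁅ e ⁆
  ∪⁅⁆-─-Lt = subset-ext pointwise
    where
    pointwise : ∀ i → lookup ((B ∪ ⁅ e ⁆) ─ Lt k) i ≡ lookup ((B ─ Lt k) ∪ ⁅ e ⁆) i
    pointwise i rewrite lookup-─ (B ∪ ⁅ e ⁆) (Lt k) i | lookup-∪ (B ─ Lt k) ⁅ e ⁆ i | lookup-─ B (Lt k) i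
      | lookup-∪ B ⁅ e ⁆ i | lookup-Lt k i | lookup-⁅⁆ e i
      with toℕ i <ᵇ k | toℕ i <ᵇ suc k | k <ᵇ toℕ i | toℕ i ≡ᵇ k | position i e | lookup B i
    ... | _ | _ | _ | _ | before | true = refl
    ... | _ | _ | _ | _ | before | false = refl
    ... | _ | _ | _ | _ | after | true = refl
    ... | _ | _ | _ | _ | after | false = refl
    ... | _ | _ | _ | _ | at refl | true = refl
    ... | _ | _ | _ | _ | at refl | false = refl

Lt-0 : Lt {n} 0 ≡ ⊥
Lt-0 = subset-ext λ i → trans (lookup-Lt 0 i) (sym (lookup-⊥ i))

Lt-n : Lt {n} n ≡ ⊤
Lt-n {n} = subset-ext λ i → trans (lookup-Lt n i) (trans (<⇒<ᵇ _ _ (FinP.toℕ<n i)) (sym (lookup-⊤ i)))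

setAt-∩-Gt : (e : Fin n) (b : Bool) (A : Subset n) → setAt (toℕ e) b A ∩ Gt e ≡ A ∩ Gt e
setAt-∩-Gt e b A = subset-ext pointwise
  where
  pointwise : ∀ i → lookup (setAt (toℕ e) b A ∩ Gt e) i ≡ lookup (A ∩ Gt e) i
  pointwise i rewrite lookup-∩ (setAt (toℕ e) b A) (Gt e) i | lookup-∩ A (Gt e) i | lookup-setAt (toℕ e) b A i | lookup-Gt e i
    with toℕ i <ᵇ toℕ e | toℕ i <ᵇ suc (toℕ e) | toℕ e <ᵇ toℕ i | toℕ i ≡ᵇ toℕ e | position i e
  ... | _ | _ | _ | _ | before = trans (𝔹P.∧-zeroʳ _) (sym (𝔹P.∧-zeroʳ _))
  ... | _ | _ | _ | _ | at refl = trans (𝔹P.∧-zeroʳ _) (sym (𝔹P.∧-zeroʳ _))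
  ... | _ | _ | _ | _ | after = refl

agreeFrom-∩-Gt : (e : Fin n) (X B : Subset n) → AgreeFrom (toℕ e) X B → B ∩ Gt e ≡ X ∩ Gt e
agreeFrom-∩-Gt e X B agree = subset-ext pointwise
  where
  pointwise : ∀ i → lookup (B ∩ Gt e) i ≡ lookup (X ∩ Gt e) i
  pointwise i rewrite lookup-∩ B (Gt e) i | lookup-∩ X (Gt e) i | lookup-Gt e i with toℕ e <ᵇ toℕ i in e<i
  ... | false = trans (𝔹P.∧-zeroʳ _) (sym (𝔹P.∧-zeroʳ _))
  ... | true = cong (_∧ true) (agree i (ℕP.<⇒≤ (<ᵇ⇒< _ _ e<i)))

agreeFrom-at : (e : Fin n) (b : Bool) (A B : Subset n) → AgreeFrom (toℕ e) (setAt (toℕ e) b A) B → lookup B e ≡ b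
agreeFrom-at e b A B agree = trans (agree e ℕP.≤-refl)
  (trans (lookup-setAt (toℕ e) b A e) (cong (λ c → if c then b else lookup A e) (≡ᵇ-refl (toℕ e))))

setAt-true : (e : Fin n) (B : Subset n) → setAt (toℕ e) true B ≡ B ∪ ⁅ e ⁆
setAt-true e B = subset-ext λ i → trans (lookup-setAt (toℕ e) true B i)
  (sym (trans (lookup-∪ B ⁅ e ⁆ i) (trans (cong (lookup B i ∨_) (lookup-⁅⁆ e i)) (∨-as-if (toℕ i ≡ᵇ toℕ e)))))
  where
  ∨-as-if : ∀ {a} c → (a ∨ c) ≡ (if c then true else a)
  ∨-as-if true = 𝔹P.∨-zeroʳ _
  ∨-as-if false = 𝔹P.∨-identityʳ _

bit : Bool → ℕ
bit true = 1
bit false = 0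

countBelow : ℕ → (Fin n → Bool) → ℕ
countBelow k P = ∣ tabulate (λ i → (toℕ i <ᵇ k) ∧ P i) ∣

countBelow-0 : (P : Fin n → Bool) → countBelow 0 P ≡ 0
countBelow-0 {zero} P = refl
countBelow-0 {suc n} P = countBelow-0 {n} (P ∘ suc)

countBelow-suc : (P : Fin n → Bool) (e : Fin n) → countBelow (suc (toℕ e)) P ≡ bit (P e) + countBelow (toℕ e) P
countBelow-suc {suc n} P zero with P zero
... | true = refl
... | false = refl
countBelow-suc {suc n} P (suc e) with P zero | countBelow-suc (P ∘ suc) e
... | true | ih = trans (cong suc ih) (sym (ℕP.+-suc (bit (P (suc e))) _))
... | false | ih = ih

countBelow-n : (P : Fin n → Bool) → countBelow n P ≡ ∣ tabulate P ∣
countBelow-n {n} P = cong ∣_∣ (tabulate-cong λ f → cong (_∧ P f) (<⇒<ᵇ _ _ (FinP.toℕ<n f)))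

level-induction : (P : ℕ → Set) → P 0 → (∀ (e : Fin n) → P (toℕ e) → P (suc (toℕ e))) → ∀ k → k ≤ n → P k
level-induction P base step zero _ = base
level-induction P base step (suc k) le =
  subst P (cong suc (FinP.toℕ-fromℕ< le))
    (step (fromℕ< le) (subst P (sym (FinP.toℕ-fromℕ< le)) (level-induction P base step k (ℕP.≤-trans (ℕP.n≤1+n k) le))))

-- Abstract rank functions.  The level argument only uses these three properties,
-- which the rank function of a matroid has (Rank above).

record IsRankFunction {n : ℕ} (ρ : Subset n → ℕ) : Set where
  field
    mono : ∀ {X Y} → X ⊆ Y → ρ X ≤ ρ Y
    unit : ∀ X e → ρ (X ∪ ⁅ e ⁆) ≤ suc (ρ X)
    closure-mono : ∀ {X Y} e → X ⊆ Y → ρ (X ∪ ⁅ e ⁆) ≡ ρ X → ρ (Y ∪ ⁅ e ⁆) ≡ ρ Y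

matroid-isRankFunction : {n : ℕ} (N : Matroid n) → IsRankFunction (rk N)
matroid-isRankFunction N = record
  { mono = Rank.rk-mono N ; unit = Rank.rk-∪⁅⁆-≤ N ; closure-mono = Rank.rank-closure-mono N }

∸-unitStep : {a b c : ℕ} → a ≤ b → b ≤ c → c ≤ suc b → c ∸ a ≡ bit (not ⌊ c ℕ.≟ b ⌋) + (b ∸ a)
∸-unitStep {a} {b} {c} a≤b b≤c c≤1+b with ℕP.m≤n⇒m<n∨m≡n b≤c
... | inj₂ refl rewrite ⌊⌋-true (b ℕ.≟ b) refl = refl
... | inj₁ b<c with ℕP.≤-antisym c≤1+b b<c
...   | refl rewrite ⌊⌋-false (suc b ℕ.≟ b) (λ eq → ℕP.<-irrefl (sym eq) (ℕP.n<1+n b)) = ℕP.+-∸-assoc 1 a≤b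

∸-nullityStep : {g g' b y : ℕ} → g ≤ g' → g' ≤ suc g → g' ≤ b → b ∸ g' ≤ y →
                suc y ∸ (b ∸ g) ≡ bit ⌊ g' ℕ.≟ g ⌋ + (y ∸ (b ∸ g'))
∸-nullityStep {g} {g'} {b} {y} g≤g' g'≤1+g g'≤b b∸g'≤y with ℕP.m≤n⇒m<n∨m≡n g≤g'
... | inj₂ refl rewrite ⌊⌋-true (g ℕ.≟ g) refl = ℕP.+-∸-assoc 1 b∸g'≤y
... | inj₁ g<g' with ℕP.≤-antisym g'≤1+g g<g'
...   | refl rewrite ⌊⌋-false (suc g ℕ.≟ g) (λ eq → ℕP.<-irrefl (sym eq) (ℕP.n<1+n g)) | ℕP.+-∸-assoc 1 g'≤b = refl

∸-bit-+ : (c c' : Bool) {a a' : ℕ} → a' ≤ a → (c' ≡ true → c ≡ true) →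
          (bit c + a) ∸ (bit c' + a') ≡ (bit c ∸ bit c') + (a ∸ a')
∸-bit-+ true true le h = refl
∸-bit-+ true false le h = ℕP.+-∸-assoc 1 le
∸-bit-+ false false le h = refl
∸-bit-+ false true le h with h refl
... | ()

∸-∸-swap : ∀ {R a R' a'} → a ≤ R → a' ≤ R' → (R ∸ a) ∸ (R' ∸ a') ≡ (R + a') ∸ (R' + a)
∸-∸-swap {R} {a} {R'} {a'} a≤R a'≤R' = sym (begin
  (R + a') ∸ (R' + a)
    ≡⟨ cong₂ _∸_ (cong (_+ a') (sym (ℕP.m∸n+n≡m a≤R))) (cong (_+ a) (sym (ℕP.m∸n+n≡m a'≤R'))) ⟩
  ((R ∸ a) + a + a') ∸ ((R' ∸ a') + a' + a)
    ≡⟨ cong₂ _∸_ (rotate (R ∸ a) a a') (trans (rotate (R' ∸ a') a' a) (cong (_+ (R' ∸ a')) (ℕP.+-comm a' a))) ⟩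
  ((a + a') + (R ∸ a)) ∸ ((a + a') + (R' ∸ a'))
    ≡⟨ ℕP.[m+n]∸[m+o]≡n∸o (a + a') (R ∸ a) (R' ∸ a') ⟩
  (R ∸ a) ∸ (R' ∸ a') ∎)
  where
  open ≡-Reasoning
  rotate : ∀ p q r → p + q + r ≡ (q + r) + p
  rotate p q r = trans (ℕP.+-assoc p q r) (ℕP.+-comm p (q + r))

module LevelRank {n : ℕ} (ρ : Subset n → ℕ) (isRank : IsRankFunction ρ) where
  open IsRankFunction isRank

  extActive : Subset n → Fin n → Bool
  extActive G e = inClosure ρ G e

  intActive : Subset n → Fin n → Bool
  intActive G e = not (inClosure ρ (G ∪ Lt (toℕ e)) e)

  corankBelow : ℕ → Subset n → ℕ
  corankBelow k B = ρ (Lt k ∪ B) ∸ ρ B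

  ∩-Gt-⊆ : (B : Subset n) (e : Fin n) → B ∩ Gt e ⊆ B
  ∩-Gt-⊆ B e = ⊆-byLookup λ i h → proj₁ (lookup-∩⁻ B (Gt e) i h)

  absent-⊆ : (B : Subset n) (e : Fin n) → lookup B e ≡ false → B ⊆ (B ∩ Gt e) ∪ Lt (toℕ e)
  absent-⊆ B e Be = subst (B ⊆_) (AroundPosition.Lt-∪-absent B e Be) (q⊆p∪q (Lt (toℕ e)) B)

  corankBelow-absent : (B : Subset n) (e : Fin n) → lookup B e ≡ false →
                       corankBelow (suc (toℕ e)) B ≡ bit (intActive (B ∩ Gt e) e) + corankBelow (toℕ e) B
  corankBelow-absent B e Be rewrite AroundPosition.Lt-suc-∪-absent B e Be | AroundPosition.Lt-∪-absent B e Be =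
    ∸-unitStep (mono (absent-⊆ B e Be)) (mono (p⊆p∪q ⁅ e ⁆)) (unit _ e)

  corankBelow-present : (B : Subset n) (e : Fin n) → lookup B e ≡ true →
                        corankBelow (suc (toℕ e)) B ≡ corankBelow (toℕ e) B
  corankBelow-present B e Be rewrite AroundPosition.Lt-suc-∪-present B e Be = refl

  extActive⇒¬intActive : (G : Subset n) (e : Fin n) → extActive G e ≡ true → intActive G e ≡ false
  extActive⇒¬intActive G e h =
    cong not (⌊⌋-true (_ ℕ.≟ _) (closure-mono e (p⊆p∪q (Lt (toℕ e))) (⌊⌋-elim (_ ℕ.≟ _) h)))

  intActive⇒rank-step : (G : Subset n) (e : Fin n) → intActive G e ≡ true →
                        ∀ Z → Z ⊆ G ∪ Lt (toℕ e) → ρ (Z ∪ ⁅ e ⁆) ≡ suc (ρ Z)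
  intActive⇒rank-step G e h Z Z⊆ = ℕP.≤-antisym (unit Z e)
    (ℕP.≤∧≢⇒< (mono (p⊆p∪q ⁅ e ⁆)) λ eq → ⌊⌋-elim' (_ ℕ.≟ _) (not-true h) (closure-mono e Z⊆ (sym eq)))

  corankBelow-insert-ext : (B : Subset n) (e : Fin n) → extActive (B ∩ Gt e) e ≡ true →
                           corankBelow (toℕ e) (B ∪ ⁅ e ⁆) ≡ corankBelow (toℕ e) B
  corankBelow-insert-ext B e h rewrite sym (∪-assoc (Lt (toℕ e)) B ⁅ e ⁆)
    | closure-mono e (⊆-trans (∩-Gt-⊆ B e) (q⊆p∪q (Lt (toℕ e)) B)) (⌊⌋-elim (_ ℕ.≟ _) h)
    | closure-mono e (∩-Gt-⊆ B e) (⌊⌋-elim (_ ℕ.≟ _) h) = refl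

  corankBelow-insert-int : (B : Subset n) (e : Fin n) → lookup B e ≡ false → intActive (B ∩ Gt e) e ≡ true →
                           corankBelow (toℕ e) (B ∪ ⁅ e ⁆) ≡ corankBelow (toℕ e) B
  corankBelow-insert-int B e Be h rewrite sym (∪-assoc (Lt (toℕ e)) B ⁅ e ⁆)
    | intActive⇒rank-step (B ∩ Gt e) e h (Lt (toℕ e) ∪ B)
        (subst (_⊆ (B ∩ Gt e) ∪ Lt (toℕ e)) (sym (AroundPosition.Lt-∪-absent B e Be)) ⊆-refl)
    | intActive⇒rank-step (B ∩ Gt e) e h B (absent-⊆ B e Be) = refl

  corankBelow-0 : (B : Subset n) → corankBelow 0 B ≡ 0
  corankBelow-0 B rewrite Lt-0 {n} | ∪-identityˡ B = ℕP.n∸n≡0 (ρ B)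

  corankBelow-n : (B : Subset n) → corankBelow n B ≡ ρ ⊤ ∸ ρ B
  corankBelow-n B rewrite Lt-n {n} | ∪-zeroˡ B = refl

record Stats : Set where
  constructor stats
  field corank nullity external internal relCorank : ℕ

stats-cong : ∀ {a b c d e a' b' c' d' e'} → a ≡ a' → b ≡ b' → c ≡ c' → d ≡ d' → e ≡ e' →
             stats a b c d e ≡ stats a' b' c' d' e'
stats-cong refl refl refl refl refl = refl

-- Level statistics for a pair of rank functions r (of M) and r' (of M') such that
-- M-closures are contained in M'-closures, which is what a perspective provides.

module LevelStatistics {n : ℕ} (r r' : Subset n → ℕ) (isRank : IsRankFunction r) (isRank' : IsRankFunction r')
  (perspective : ∀ X e → r (X ∪ ⁅ e ⁆) ≡ r X → r' (X ∪ ⁅ e ⁆) ≡ r' X) where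

  module M = LevelRank r isRank
  module M' = LevelRank r' isRank'
  open IsRankFunction isRank

  nullityBelow : ℕ → Subset n → ℕ
  nullityBelow k B = ∣ B ∩ Lt k ∣ ∸ (r B ∸ r (B ─ Lt k))

  extBelow : ℕ → Subset n → ℕ
  extBelow k B = countBelow k (λ f → not (lookup B f) ∧ M.extActive (B ∩ Gt f) f)

  intBelow : ℕ → Subset n → ℕ
  intBelow k B = countBelow k (λ f → lookup B f ∧ M'.intActive (B ∩ Gt f) f)

  rcdBelow : ℕ → Subset n → ℕ
  rcdBelow k B = M.corankBelow k B ∸ M'.corankBelow k B

  statsBelow : ℕ → Subset n → Stats
  statsBelow k B = stats (M'.corankBelow k B) (nullityBelow k B) (extBelow k B) (intBelow k B) (rcdBelow k B)

  intActive'⇒intActive : (G : Subset n) (e : Fin n) → M'.intActive G e ≡ true → M.intActive G e ≡ true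
  intActive'⇒intActive G e h with M.intActive G e in q
  ... | true = refl
  ... | false = ⊥-elim (true≢false h (cong not (⌊⌋-true (_ ℕ.≟ _)
                  (perspective _ e (⌊⌋-elim (_ ℕ.≟ _) (trans (sym (𝔹P.not-involutive _)) (cong not q)))))))

  extActive⇒extActive' : (G : Subset n) (e : Fin n) → M.extActive G e ≡ true → M'.extActive G e ≡ true
  extActive⇒extActive' G e h = ⌊⌋-true (_ ℕ.≟ _) (perspective G e (⌊⌋-elim (_ ℕ.≟ _) h))

  -- the elements below k raise the rank by at most their number, so nullityBelow does not truncate
  rank-drop-bound : ∀ k → k ≤ n → ∀ B → r B ∸ r (B ─ Lt k) ≤ ∣ B ∩ Lt k ∣
  rank-drop-bound k le B = ℕP.m≤n+o⇒m∸n≤o (r B) (r (B ─ Lt k)) (level-induction Bound base step k le B)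
    where
    Bound : ℕ → Set
    Bound k = ∀ B → r B ≤ r (B ─ Lt k) + ∣ B ∩ Lt k ∣
    base : Bound 0
    base B rewrite Lt-0 {n} | p─⊥≡p B = ℕP.m≤m+n _ _
    step : ∀ (e : Fin n) → Bound (toℕ e) → Bound (suc (toℕ e))
    step e ih B with lookup B e in Be
    ... | false rewrite AroundPosition.─Lt-suc-absent B e Be | AroundPosition.∩-Lt-suc-absent B e Be = ih B
    ... | true rewrite AroundPosition.─Lt-suc B e | AroundPosition.∩-Lt-suc-present B e Be
          | ∣∪⁅⁆∣ (B ∩ Lt (toℕ e)) e (AroundPosition.e∉∩Lt B e) | ℕP.+-suc (r (B ∩ Gt e)) ∣ B ∩ Lt (toℕ e) ∣ =
      ℕP.≤-trans (ih B) (subst (λ X → r X + ∣ B ∩ Lt (toℕ e) ∣ ≤ suc (r (B ∩ Gt e) + ∣ B ∩ Lt (toℕ e) ∣))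
        (sym (AroundPosition.─Lt-present B e Be)) (ℕP.+-monoˡ-≤ ∣ B ∩ Lt (toℕ e) ∣ (unit (B ∩ Gt e) e)))

  -- the M'-corank part never exceeds the M-corank part, so rcdBelow does not truncate
  corank-dominated : ∀ k → k ≤ n → ∀ B → M'.corankBelow k B ≤ M.corankBelow k B
  corank-dominated = level-induction Dominated base step
    where
    Dominated : ℕ → Set
    Dominated k = ∀ B → M'.corankBelow k B ≤ M.corankBelow k B
    base : Dominated 0
    base B rewrite M'.corankBelow-0 B | M.corankBelow-0 B = z≤n
    step : ∀ (e : Fin n) → Dominated (toℕ e) → Dominated (suc (toℕ e))
    step e ih B with lookup B e in Be
    ... | true rewrite M'.corankBelow-present B e Be | M.corankBelow-present B e Be = ih B
    ... | false rewrite M'.corankBelow-absent B e Be | M.corankBelow-absent B e Be with M'.intActive (B ∩ Gt e) e in c'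
    ...   | false = ℕP.≤-trans (ih B) (ℕP.m≤n+m _ _)
    ...   | true rewrite intActive'⇒intActive (B ∩ Gt e) e c' = s≤s (ih B)

  stats-absent : (e : Fin n) (B : Subset n) → lookup B e ≡ false →
    let G = B ∩ Gt e ; s = statsBelow (toℕ e) B in
    statsBelow (suc (toℕ e)) B ≡
      stats (bit (M'.intActive G e) + Stats.corank s) (Stats.nullity s) (bit (M.extActive G e) + Stats.external s) (Stats.internal s)
            ((bit (M.intActive G e) ∸ bit (M'.intActive G e)) + Stats.relCorank s)
  stats-absent e B Be = stats-cong (M'.corankBelow-absent B e Be) nullity-step
    (trans (countBelow-suc _ e) (cong (λ b → bit (not b ∧ M.extActive (B ∩ Gt e) e) + extBelow (toℕ e) B) Be))
    (trans (countBelow-suc _ e) (cong (λ b → bit (b ∧ M'.intActive (B ∩ Gt e) e) + intBelow (toℕ e) B) Be))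
    rcd-step
    where
    nullity-step : nullityBelow (suc (toℕ e)) B ≡ nullityBelow (toℕ e) B
    nullity-step rewrite AroundPosition.∩-Lt-suc-absent B e Be | AroundPosition.─Lt-suc-absent B e Be = refl
    rcd-step : rcdBelow (suc (toℕ e)) B ≡ (bit (M.intActive (B ∩ Gt e) e) ∸ bit (M'.intActive (B ∩ Gt e) e)) + rcdBelow (toℕ e) B
    rcd-step rewrite M.corankBelow-absent B e Be | M'.corankBelow-absent B e Be =
      ∸-bit-+ (M.intActive (B ∩ Gt e) e) (M'.intActive (B ∩ Gt e) e)
        (corank-dominated (toℕ e) (ℕP.<⇒≤ (FinP.toℕ<n e)) B) (intActive'⇒intActive (B ∩ Gt e) e)

  nullity-present : (e : Fin n) (B : Subset n) → lookup B e ≡ true →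
                    nullityBelow (suc (toℕ e)) B ≡ bit (M.extActive (B ∩ Gt e) e) + nullityBelow (toℕ e) B
  nullity-present e B Be rewrite AroundPosition.∩-Lt-suc-present B e Be
    | ∣∪⁅⁆∣ (B ∩ Lt (toℕ e)) e (AroundPosition.e∉∩Lt B e) | AroundPosition.─Lt-suc B e | AroundPosition.─Lt-present B e Be =
    ∸-nullityStep (mono (p⊆p∪q ⁅ e ⁆)) (unit (B ∩ Gt e) e) (mono G∪e⊆B)
      (subst (λ X → r B ∸ r X ≤ ∣ B ∩ Lt (toℕ e) ∣) (AroundPosition.─Lt-present B e Be)
             (rank-drop-bound (toℕ e) (ℕP.<⇒≤ (FinP.toℕ<n e)) B))
    where
    G∪e⊆B : (B ∩ Gt e) ∪ ⁅ e ⁆ ⊆ B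
    G∪e⊆B = subst (_⊆ B) (AroundPosition.─Lt-present B e Be) (p─q⊆p B (Lt (toℕ e)))

  stats-present : (e : Fin n) (B : Subset n) → lookup B e ≡ true →
    let G = B ∩ Gt e ; s = statsBelow (toℕ e) B in
    statsBelow (suc (toℕ e)) B ≡
      stats (Stats.corank s) (bit (M.extActive G e) + Stats.nullity s) (Stats.external s) (bit (M'.intActive G e) + Stats.internal s)
            (0 + Stats.relCorank s)
  stats-present e B Be = stats-cong (M'.corankBelow-present B e Be) (nullity-present e B Be)
    (trans (countBelow-suc _ e) (cong (λ b → bit (not b ∧ M.extActive (B ∩ Gt e) e) + extBelow (toℕ e) B) Be))
    (trans (countBelow-suc _ e) (cong (λ b → bit (b ∧ M'.intActive (B ∩ Gt e) e) + intBelow (toℕ e) B) Be))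
    rcd-step
    where
    rcd-step : rcdBelow (suc (toℕ e)) B ≡ rcdBelow (toℕ e) B
    rcd-step rewrite M.corankBelow-present B e Be | M'.corankBelow-present B e Be = refl

  nullity-insert-ext : (e : Fin n) (B : Subset n) → lookup B e ≡ false → M.extActive (B ∩ Gt e) e ≡ true →
                       nullityBelow (toℕ e) (B ∪ ⁅ e ⁆) ≡ nullityBelow (toℕ e) B
  nullity-insert-ext e B Be h rewrite AroundPosition.∪⁅⁆-∩-Lt B e | AroundPosition.∪⁅⁆-─-Lt B e
    | AroundPosition.─Lt-absent B e Be | ⌊⌋-elim (_ ℕ.≟ _) h | closure-mono e (M.∩-Gt-⊆ B e) (⌊⌋-elim (_ ℕ.≟ _) h) = refl

  nullity-insert-int : (e : Fin n) (B : Subset n) → lookup B e ≡ false → M.intActive (B ∩ Gt e) e ≡ true →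
                       nullityBelow (toℕ e) (B ∪ ⁅ e ⁆) ≡ nullityBelow (toℕ e) B
  nullity-insert-int e B Be h rewrite AroundPosition.∪⁅⁆-∩-Lt B e | AroundPosition.∪⁅⁆-─-Lt B e
    | AroundPosition.─Lt-absent B e Be
    | M.intActive⇒rank-step (B ∩ Gt e) e h B (M.absent-⊆ B e Be)
    | M.intActive⇒rank-step (B ∩ Gt e) e h (B ∩ Gt e) (⊆-trans (M.∩-Gt-⊆ B e) (M.absent-⊆ B e Be)) = refl

  statsBelow-0 : (A : Subset n) → statsBelow 0 A ≡ stats 0 0 0 0 0
  statsBelow-0 A = stats-cong (M'.corankBelow-0 A) nullity-0
                              (countBelow-0 {n} (λ f → not (lookup A f) ∧ M.extActive (A ∩ Gt f) f))
                              (countBelow-0 {n} (λ f → lookup A f ∧ M'.intActive (A ∩ Gt f) f))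
                              (cong₂ _∸_ (M.corankBelow-0 A) (M'.corankBelow-0 A))
    where
    nullity-0 : nullityBelow 0 A ≡ 0
    nullity-0 rewrite Lt-0 {n} | ∩-zeroʳ A | ∣⊥∣≡0 n = ℕP.0∸n≡0 (r A ∸ r (A ─ ⊥))

-- For x the counters are (cr', ι'),
-- for y they are (ε, nl): both grow in the first argument when an element is left
-- out of the set and in the second one when it is put in.

record Weight (s : ℚ) : Set where
  field
    w : ℕ → ℕ → ℚ
    absent present : ℚ
    w-0 : w 0 0 ≡ 1ℚ
    w-absent : ∀ a p → w (suc a) p ≡ absent * w a p
    w-present : ∀ a p → w a (suc p) ≡ present * w a p
    split : absent +ℚ present ≡ s

  absentIf : Bool → ℚ
  absentIf b = if b then absent else 1ℚ

  presentIf : Bool → ℚ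
  presentIf b = if b then present else 1ℚ

  w-absentIf : ∀ b a p → w (bit b + a) p ≡ absentIf b * w a p
  w-absentIf true a p = w-absent a p
  w-absentIf false a p = sym (ℚP.*-identityˡ _)

  w-presentIf : ∀ b a p → w a (bit b + p) ≡ presentIf b * w a p
  w-presentIf true a p = w-present a p
  w-presentIf false a p = sym (ℚP.*-identityˡ _)

absentPower : (s : ℚ) → Weight s
absentPower s = record
  { w = λ a p → (s - 1ℚ) ^ a ; absent = s - 1ℚ ; present = 1ℚ ; w-0 = refl
  ; w-absent = λ a p → refl ; w-present = λ a p → sym (ℚP.*-identityˡ _)
  ; split = solve 1 (λ s → (s :- con 1ℚ) :+ con 1ℚ := s) refl s }

presentPower : (s : ℚ) → Weight s
presentPower s = record
  { w = λ a p → (s - 1ℚ) ^ p ; absent = 1ℚ ; present = s - 1ℚ ; w-0 = refl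
  ; w-absent = λ a p → sym (ℚP.*-identityˡ _) ; w-present = λ a p → refl
  ; split = solve 1 (λ s → con 1ℚ :+ (s :- con 1ℚ) := s) refl s }

^-+ : (q : ℚ) (m d : ℕ) → q ^ (m + d) ≡ (q ^ m) * (q ^ d)
^-+ q zero d = sym (ℚP.*-identityˡ _)
^-+ q (suc m) d = trans (cong (q *_) (^-+ q m d)) (sym (ℚP.*-assoc q _ _))

module WeightIndependence {n : ℕ} (r r' : Subset n → ℕ) (isRank : IsRankFunction r) (isRank' : IsRankFunction r')
  (perspective : ∀ X e → r (X ∪ ⁅ e ⁆) ≡ r X → r' (X ∪ ⁅ e ⁆) ≡ r' X) (x y z : ℚ) where

  open LevelStatistics r r' isRank isRank' perspective
  open Weight

  value : Weight x → Weight y → Stats → ℚ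
  value U V s = w U (Stats.corank s) (Stats.internal s) * w V (Stats.external s) (Stats.nullity s) * (z ^ Stats.relCorank s)

  levelSum : Weight x → Weight y → ℕ → Subset n → ℚ
  levelSum U V k A = ΣBelow k A (λ B → value U V (statsBelow k B))

  -- the reference pair, whose value ignores the activities
  tutteX : Weight x
  tutteX = absentPower x

  tutteY : Weight y
  tutteY = presentPower y

  value-step : (U : Weight x) (V : Weight y) {c i c' i' l e l' e' : ℕ} (a b : ℚ) (m d : ℕ) →
               w U c' i' ≡ a * w U c i → w V e' l' ≡ b * w V e l →
               value U V (stats c' l' e' i' (m + d)) ≡ (a * b * (z ^ m)) * value U V (stats c l e i d)
  value-step U V {c} {i} {c'} {i'} {l} {e} {l'} {e'} a b m d hU hV =
    trans (cong₂ _*_ (cong₂ _*_ hU hV) (^-+ z m d)) (regroup a b (z ^ m) (w U c i) (w V e l) (z ^ d))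
    where
    regroup : (a b c P Q R : ℚ) → (a * P) * (b * Q) * (c * R) ≡ (a * b * c) * (P * Q * R)
    regroup = solve 6 (λ a b c P Q R → (a :* P) :* (b :* Q) :* (c :* R) := (a :* b :* c) :* (P :* Q :* R)) refl

  -- the coefficients of the two halves when the element e = k is released; they
  -- depend only on the activities L (external, M), C (internal, M), C' (internal, M')
  absentCoeff : Weight x → Weight y → Bool → Bool → Bool → ℚ
  absentCoeff U V L C C' = absentIf U C' * absentIf V L * (z ^ (bit C ∸ bit C'))

  presentCoeff : Weight x → Weight y → Bool → Bool → ℚ
  presentCoeff U V L C' = presentIf U C' * presentIf V L * (z ^ 0)

  levelSum-step : (U : Weight x) (V : Weight y) (e : Fin n) (A : Subset n) →
    let G = A ∩ Gt e ; L = M.extActive G e ; C = M.intActive G e ; C' = M'.intActive G e in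
    levelSum U V (suc (toℕ e)) A ≡ absentCoeff U V L C C' * levelSum U V (toℕ e) (setAt (toℕ e) false A)
                                   +ℚ presentCoeff U V L C' * levelSum U V (toℕ e) (setAt (toℕ e) true A)
  levelSum-step U V e A = cong₂ _+ℚ_ (half false absentCoeff′ absentPart) (half true presentCoeff′ presentPart)
    where
    k = toℕ e
    G = A ∩ Gt e
    f : Subset n → ℚ
    f B = value U V (statsBelow k B)
    absentCoeff′ : Subset n → ℚ
    absentCoeff′ H = absentCoeff U V (M.extActive H e) (M.intActive H e) (M'.intActive H e)
    presentCoeff′ : Subset n → ℚ
    presentCoeff′ H = presentCoeff U V (M.extActive H e) (M'.intActive H e)
    sameTail : ∀ b B → AgreeFrom k (setAt k b A) B → B ∩ Gt e ≡ G
    sameTail b B agree = trans (agreeFrom-∩-Gt e _ B agree) (setAt-∩-Gt e b A)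
    half : (b : Bool) (coeff : Subset n → ℚ) →
           (∀ B → AgreeFrom k (setAt k b A) B → value U V (statsBelow (suc k) B) ≡ coeff (B ∩ Gt e) * f B) →
           ΣBelow k (setAt k b A) (λ B → value U V (statsBelow (suc k) B)) ≡ coeff G * ΣBelow k (setAt k b A) f
    half b coeff part = trans
      (ΣBelow-cong k (setAt k b A) _ (λ B → coeff G * f B)
        (λ B agree → trans (part B agree) (cong (λ H → coeff H * f B) (sameTail b B agree))))
      (ΣBelow-scale k (setAt k b A) (coeff G) f)
    absentPart : ∀ B → AgreeFrom k (setAt k false A) B → value U V (statsBelow (suc k) B) ≡ absentCoeff′ (B ∩ Gt e) * f B
    absentPart B agree = let H = B ∩ Gt e ; s = statsBelow k B in
      trans (cong (value U V) (stats-absent e B (agreeFrom-at e false A B agree)))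
        (value-step U V (absentIf U (M'.intActive H e)) (absentIf V (M.extActive H e))
          (bit (M.intActive H e) ∸ bit (M'.intActive H e)) (Stats.relCorank s)
          (w-absentIf U (M'.intActive H e) (Stats.corank s) (Stats.internal s))
          (w-absentIf V (M.extActive H e) (Stats.external s) (Stats.nullity s)))
    presentPart : ∀ B → AgreeFrom k (setAt k true A) B → value U V (statsBelow (suc k) B) ≡ presentCoeff′ (B ∩ Gt e) * f B
    presentPart B agree = let H = B ∩ Gt e ; s = statsBelow k B in
      trans (cong (value U V) (stats-present e B (agreeFrom-at e true A B agree)))
        (value-step U V (presentIf U (M'.intActive H e)) (presentIf V (M.extActive H e)) 0 (Stats.relCorank s)
          (w-presentIf U (M'.intActive H e) (Stats.corank s) (Stats.internal s))
          (w-presentIf V (M.extActive H e) (Stats.external s) (Stats.nullity s)))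

  -- For the reference weights, an active e contributes nothing: inserting it into
  -- a summand B changes neither cr', nl nor rcd at the current level.
  active-halves-agree : (e : Fin n) (A : Subset n) →
    (M.extActive (A ∩ Gt e) e ≡ true ⊎ M'.intActive (A ∩ Gt e) e ≡ true) →
    levelSum tutteX tutteY (toℕ e) (setAt (toℕ e) true A) ≡ levelSum tutteX tutteY (toℕ e) (setAt (toℕ e) false A)
  active-halves-agree e A active =
    trans (ΣBelow-setAt k k ℕP.≤-refl A f) (ΣBelow-cong k (setAt k false A) (f ∘ setAt k true) f insert-invariant)
    where
    k = toℕ e
    f : Subset n → ℚ
    f B = value tutteX tutteY (statsBelow k B)
    insert-invariant : ∀ B → AgreeFrom k (setAt k false A) B → f (setAt k true B) ≡ f B
    insert-invariant B agree rewrite setAt-true e B = byActivity active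
      where
      Be = agreeFrom-at e false A B agree
      sameTail : B ∩ Gt e ≡ A ∩ Gt e
      sameTail = trans (agreeFrom-∩-Gt e _ B agree) (setAt-∩-Gt e false A)
      same-value : ∀ {c c' l l' d d'} → c ≡ c' → l ≡ l' → d ≡ d' →
        value tutteX tutteY (stats c l (extBelow k (B ∪ ⁅ e ⁆)) (intBelow k (B ∪ ⁅ e ⁆)) d)
          ≡ value tutteX tutteY (stats c' l' (extBelow k B) (intBelow k B) d')
      same-value refl refl refl = refl
      byActivity : (M.extActive (A ∩ Gt e) e ≡ true ⊎ M'.intActive (A ∩ Gt e) e ≡ true) → f (B ∪ ⁅ e ⁆) ≡ f B
      byActivity (inj₁ extA) = same-value (M'.corankBelow-insert-ext B e ext') (nullity-insert-ext e B Be ext)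
                                          (cong₂ _∸_ (M.corankBelow-insert-ext B e ext) (M'.corankBelow-insert-ext B e ext'))
        where
        ext : M.extActive (B ∩ Gt e) e ≡ true
        ext = trans (cong (λ H → M.extActive H e) sameTail) extA
        ext' = extActive⇒extActive' (B ∩ Gt e) e ext
      byActivity (inj₂ intA') = same-value (M'.corankBelow-insert-int B e Be int') (nullity-insert-int e B Be int)
                                           (cong₂ _∸_ (M.corankBelow-insert-int B e Be int) (M'.corankBelow-insert-int B e Be int'))
        where
        int' : M'.intActive (B ∩ Gt e) e ≡ true
        int' = trans (cong (λ H → M'.intActive H e) sameTail) intA'
        int = intActive'⇒intActive (B ∩ Gt e) e int'

  -- The combination of the two halves is the same for all weights: if e is
  -- inactive the coefficients do not involve the weights, and if e is active the
  -- halves are equal and only absent + present = x (or y) enters.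
  step-independent : (U : Weight x) (V : Weight y) (L C C' : Bool) →
    (L ≡ true → C' ≡ false) → (L ≡ true → C ≡ false) → (C' ≡ true → C ≡ true) →
    (a b : ℚ) → (L ≡ true ⊎ C' ≡ true → b ≡ a) →
    absentCoeff U V L C C' * a +ℚ presentCoeff U V L C' * b
      ≡ absentCoeff tutteX tutteY L C C' * a +ℚ presentCoeff tutteX tutteY L C' * b
  step-independent U V true C true ¬C' ¬C C'⇒C a b halves with ¬C' refl
  ... | ()
  step-independent U V true true false ¬C' ¬C C'⇒C a b halves with ¬C refl
  ... | ()
  step-independent U V false false true ¬C' ¬C C'⇒C a b halves with C'⇒C refl
  ... | ()
  step-independent U V false C false ¬C' ¬C C'⇒C a b halves = refl
  step-independent U V true false false ¬C' ¬C C'⇒C a b halves rewrite halves (inj₁ refl) =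
    trans (collect (absent V) (present V) a)
      (trans (cong (_* a) (trans (split V) (sym (split tutteY)))) (sym (collect (absent tutteY) (present tutteY) a)))
    where
    collect : ∀ p q s → (1ℚ * p * 1ℚ) * s +ℚ (1ℚ * q * 1ℚ) * s ≡ (p +ℚ q) * s
    collect = solve 3 (λ p q s → (con 1ℚ :* p :* con 1ℚ) :* s :+ (con 1ℚ :* q :* con 1ℚ) :* s := (p :+ q) :* s) refl
  step-independent U V false true true ¬C' ¬C C'⇒C a b halves rewrite halves (inj₂ refl) =
    trans (collect (absent U) (present U) a)
      (trans (cong (_* a) (trans (split U) (sym (split tutteX)))) (sym (collect (absent tutteX) (present tutteX) a)))
    where
    collect : ∀ p q s → (p * 1ℚ * 1ℚ) * s +ℚ (q * 1ℚ * 1ℚ) * s ≡ (p +ℚ q) * s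
    collect = solve 3 (λ p q s → (p :* con 1ℚ :* con 1ℚ) :* s :+ (q :* con 1ℚ :* con 1ℚ) :* s := (p :+ q) :* s) refl

  weight-independence : (U : Weight x) (V : Weight y) → ∀ k → k ≤ n → ∀ A → levelSum U V k A ≡ levelSum tutteX tutteY k A
  weight-independence U V = level-induction (λ k → ∀ A → levelSum U V k A ≡ levelSum tutteX tutteY k A) base step
    where
    base : ∀ A → levelSum U V 0 A ≡ levelSum tutteX tutteY 0 A
    base A = trans (cong (value U V) (statsBelow-0 A))
      (trans (cong₂ (λ a b → a * b * 1ℚ) (w-0 U) (w-0 V)) (sym (cong (value tutteX tutteY) (statsBelow-0 A))))
    step : ∀ (e : Fin n) → (∀ A → levelSum U V (toℕ e) A ≡ levelSum tutteX tutteY (toℕ e) A) →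
           ∀ A → levelSum U V (suc (toℕ e)) A ≡ levelSum tutteX tutteY (suc (toℕ e)) A
    step e ih A = begin
      levelSum U V (suc (toℕ e)) A
        ≡⟨ levelSum-step U V e A ⟩
      absentCoeff U V L C C' * levelSum U V (toℕ e) A₀ +ℚ presentCoeff U V L C' * levelSum U V (toℕ e) A₁
        ≡⟨ cong₂ (λ a b → absentCoeff U V L C C' * a +ℚ presentCoeff U V L C' * b) (ih A₀) (ih A₁) ⟩
      absentCoeff U V L C C' * levelSum tutteX tutteY (toℕ e) A₀
        +ℚ presentCoeff U V L C' * levelSum tutteX tutteY (toℕ e) A₁
        ≡⟨ step-independent U V L C C' (λ h → M'.extActive⇒¬intActive G e (extActive⇒extActive' G e h))
             (M.extActive⇒¬intActive G e) (intActive'⇒intActive G e) _ _ (active-halves-agree e A) ⟩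
      absentCoeff tutteX tutteY L C C' * levelSum tutteX tutteY (toℕ e) A₀
        +ℚ presentCoeff tutteX tutteY L C' * levelSum tutteX tutteY (toℕ e) A₁
        ≡⟨ sym (levelSum-step tutteX tutteY e A) ⟩
      levelSum tutteX tutteY (suc (toℕ e)) A ∎
      where
      open ≡-Reasoning
      G = A ∩ Gt e
      L = M.extActive G e
      C = M.intActive G e
      C' = M'.intActive G e
      A₀ = setAt (toℕ e) false A
      A₁ = setAt (toℕ e) true A

module MatroidLevels {n : ℕ} (M M' : Matroid n) (P : Perspective M M') where
  open LevelStatistics (rk M) (rk M') (matroid-isRankFunction M) (matroid-isRankFunction M') (perspective-closure M M' P)

  statsBelow-n : ∀ A → statsBelow n A ≡ stats (cr M' A) (nl M A) (ε M A) (ι M' A) (rcd M M' A)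
  statsBelow-n A = stats-cong (M'.corankBelow-n A) nullity-n external-n internal-n relCorank-n
    where
    nullity-n : nullityBelow n A ≡ nl M A
    nullity-n rewrite Lt-n {n} | ∩-identityʳ A | p─⊤≡⊥ A | Rank.rk-⊥ M = refl
    relCorank-n : rcdBelow n A ≡ rcd M M' A
    relCorank-n rewrite M.corankBelow-n A | M'.corankBelow-n A =
      ∸-∸-swap (Rank.rk-≤-rank M A) (Rank.rk-≤-rank M' A)
    external-n : extBelow n A ≡ ε M A
    external-n = trans (countBelow-n (λ f → not (lookup A f) ∧ M.extActive (A ∩ Gt f) f)) (cong ∣_∣ (tabulate-cong pointwise))
      where
      pointwise : ∀ f → (not (lookup A f) ∧ M.extActive (A ∩ Gt f) f) ≡ (not ⌊ f ∈? A ⌋ ∧ Activities.externallyActive M A f)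
      pointwise f rewrite lookup∈? f A with lookup A f in Af
      ... | true = refl
      ... | false = sym (Activities.externallyActive-closure M A f Af)
    internal-n : intBelow n A ≡ ι M' A
    internal-n = trans (countBelow-n (λ f → lookup A f ∧ M'.intActive (A ∩ Gt f) f)) (cong ∣_∣ (tabulate-cong pointwise))
      where
      pointwise : ∀ f → (lookup A f ∧ M'.intActive (A ∩ Gt f) f) ≡ (⌊ f ∈? A ⌋ ∧ Activities.internallyActive M' A f)
      pointwise f rewrite lookup∈? f A with lookup A f in Af
      ... | true = sym (Activities.internallyActive-closure M' A f)
      ... | false = refl

activity-expansion : {n : ℕ} (M M' : Matroid n) → Perspective M M' → (x y z : ℚ) (U : Weight x) (V : Weight y) →
  tutte M M' x y z ≡ ΣSub n (λ A → Weight.w U (cr M' A) (ι M' A) * Weight.w V (ε M A) (nl M A) * (z ^ rcd M M' A))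
activity-expansion {n} M M' P x y z U V = begin
  tutte M M' x y z                                     ≡⟨ ΣSub-cong _ _ (λ A → sym (atLevel-n tutteX tutteY A)) ⟩
  ΣSub n (λ A → value tutteX tutteY (statsBelow n A))  ≡⟨ sym (ΣBelow-all {n} ⊥ _) ⟩
  levelSum tutteX tutteY n ⊥                           ≡⟨ sym (weight-independence U V n ℕP.≤-refl ⊥) ⟩
  levelSum U V n ⊥                                     ≡⟨ ΣBelow-all {n} ⊥ _ ⟩
  ΣSub n (λ A → value U V (statsBelow n A))            ≡⟨ ΣSub-cong _ _ (atLevel-n U V) ⟩
  ΣSub n (λ A → Weight.w U (cr M' A) (ι M' A) * Weight.w V (ε M A) (nl M A) * (z ^ rcd M M' A)) ∎
  where
  open ≡-Reasoning
  open WeightIndependence (rk M) (rk M') (matroid-isRankFunction M) (matroid-isRankFunction M') (perspective-closure M M' P) x y z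
  open LevelStatistics (rk M) (rk M') (matroid-isRankFunction M) (matroid-isRankFunction M') (perspective-closure M M' P)
    using (statsBelow)
  atLevel-n : (U : Weight x) (V : Weight y) (A : Subset n) →
    value U V (statsBelow n A) ≡ Weight.w U (cr M' A) (ι M' A) * Weight.w V (ε M A) (nl M A) * (z ^ rcd M M' A)
  atLevel-n U V A = cong (value U V) (MatroidLevels.statsBelow-n M M' P A)

halved : (s : ℚ) → Weight s
halved s = record
  { w = λ a p → (s * ½) ^ (a + p) ; absent = s * ½ ; present = s * ½ ; w-0 = refl
  ; w-absent = λ a p → refl ; w-present = λ a p → cong ((s * ½) ^_) (ℕP.+-suc a p)
  ; split = solve 1 (λ s → s :* con ½ :+ s :* con ½ := s) refl s }

presentOnly : (s : ℚ) → Weight s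
presentOnly s = record
  { w = λ a p → if isZero a then s ^ p else 0ℚ ; absent = 0ℚ ; present = s ; w-0 = refl
  ; w-absent = λ a p → sym (ℚP.*-zeroˡ (if isZero a then s ^ p else 0ℚ)) ; w-present = w-present ; split = ℚP.+-identityˡ s }
  where
  w-present : ∀ a p → (if isZero a then s ^ suc p else 0ℚ) ≡ s * (if isZero a then s ^ p else 0ℚ)
  w-present zero p = refl
  w-present (suc a) p = sym (ℚP.*-zeroʳ s)

absentOnly : (s : ℚ) → Weight s
absentOnly s = record
  { w = λ a p → if isZero p then s ^ a else 0ℚ ; absent = s ; present = 0ℚ ; w-0 = refl
  ; w-absent = w-absent ; w-present = λ a p → sym (ℚP.*-zeroˡ (if isZero p then s ^ a else 0ℚ)) ; split = ℚP.+-identityʳ s }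
  where
  w-absent : ∀ a p → (if isZero p then s ^ suc a else 0ℚ) ≡ s * (if isZero p then s ^ a else 0ℚ)
  w-absent a zero = refl
  w-absent a (suc p) = sym (ℚP.*-zeroʳ s)

spanning-isZero : {n : ℕ} (N : Matroid n) (A : Subset n) → spanning N A ≡ isZero (cr N A)
spanning-isZero N A with ℕP.m≤n⇒m<n∨m≡n (Rank.rk-≤-rank N A)
... | inj₂ eq rewrite eq | ℕP.n∸n≡0 (rank N) = ⌊⌋-true (rank N ℕ.≟ rank N) refl
... | inj₁ lt with rank N ∸ rk N A in cr≡
...   | zero = ⊥-elim (ℕP.<-irrefl refl (ℕP.<-≤-trans lt (ℕP.m∸n≡0⇒m≤n cr≡)))
...   | suc _ = ⌊⌋-false (rk N A ℕ.≟ rank N) (λ eq → ℕP.<-irrefl eq lt)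

indep-isZero : {n : ℕ} (N : Matroid n) (A : Subset n) → indep N A ≡ isZero (nl N A)
indep-isZero N A = bool-ext indep⇒ ⇒indep
  where
  indep⇒ : indep N A ≡ true → isZero (nl N A) ≡ true
  indep⇒ h rewrite Rank.indep⇒rk≡∣∣ N h | ℕP.n∸n≡0 ∣ A ∣ = refl
  ⇒indep : isZero (nl N A) ≡ true → indep N A ≡ true
  ⇒indep h with ∣ A ∣ ∸ rk N A in nl≡
  ... | zero = Rank.rk≡∣∣⇒indep N (ℕP.≤-antisym (Rank.rk-≤-∣∣ N A) (ℕP.m∸n≡0⇒m≤n nl≡))

if-*ˡ : (b : Bool) (p q r : ℚ) → (if b then p else 0ℚ) * q * r ≡ (if b then p * q * r else 0ℚ)
if-*ˡ true p q r = refl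
if-*ˡ false p q r = trans (cong (_* r) (ℚP.*-zeroˡ q)) (ℚP.*-zeroˡ r)

if-*ᵐ : (b : Bool) (p q r : ℚ) → p * (if b then q else 0ℚ) * r ≡ (if b then p * q * r else 0ℚ)
if-*ᵐ true p q r = refl
if-*ᵐ false p q r = trans (cong (_* r) (ℚP.*-zeroʳ p)) (ℚP.*-zeroˡ r)

if-*ˡᵐ : (a b : Bool) (p q r : ℚ) → (if a then p else 0ℚ) * (if b then q else 0ℚ) * r ≡ (if a ∧ b then p * q * r else 0ℚ)
if-*ˡᵐ true b p q r = if-*ᵐ b p q r
if-*ˡᵐ false b p q r = trans (cong (_* r) (ℚP.*-zeroˡ (if b then q else 0ℚ))) (ℚP.*-zeroˡ r)

if-cond : {a b : Bool} (p : ℚ) → a ≡ b → (if a then p else 0ℚ) ≡ (if b then p else 0ℚ)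
if-cond p refl = refl

-- The theorem: each identity is the activity expansion for one pair of weights
-- (the components below are (1), (2), (3), (3b), (3c), (3d), (3e), (4), (5)).

proposition3 : {n : ℕ} (M M' : Matroid n) → Perspective M M' → (x y z : ℚ) →
  (tutte M M' x y z ≡ ΣSub n (λ A → ((x - 1ℚ) ^ cr M' A) * ((y - 1ℚ) ^ nl M A) * (z ^ rcd M M' A)))
  × (tutte M M' x y z ≡ ΣSubWhen n (λ A → spanning M' A ∧ indep M A)
        (λ A → (x ^ ι M' A) * (y ^ ε M A) * (z ^ rcd M M' A)))
  × (tutte M M' x y z ≡ ΣSub n (λ A → ((x * ½) ^ (cr M' A + ι M' A)) * ((y * ½) ^ (nl M A + ε M A)) * (z ^ rcd M M' A)))
  × (tutte M M' x y z ≡ ΣSub n (λ A → ((x * ½) ^ (cr M' A + ι M' A)) * ((y - 1ℚ) ^ nl M A) * (z ^ rcd M M' A)))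
  × (tutte M M' x y z ≡ ΣSubWhen n (λ A → isZero (ε M A))
        (λ A → ((x * ½) ^ (cr M' A + ι M' A)) * (y ^ nl M A) * (z ^ rcd M M' A)))
  × (tutte M M' x y z ≡ ΣSub n (λ A → ((x - 1ℚ) ^ cr M' A) * ((y * ½) ^ (nl M A + ε M A)) * (z ^ rcd M M' A)))
  × (tutte M M' x y z ≡ ΣSubWhen n (λ A → isZero (ι M' A))
        (λ A → (x ^ cr M' A) * ((y * ½) ^ (nl M A + ε M A)) * (z ^ rcd M M' A)))
  × (tutte M M' x y z ≡ ΣSubWhen n (λ A → spanning M' A)
        (λ A → (x ^ ι M' A) * ((y - 1ℚ) ^ nl M A) * (z ^ rcd M M' A)))
  × (tutte M M' x y z ≡ ΣSubWhen n (λ A → indep M A)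
        (λ A → ((x - 1ℚ) ^ cr M' A) * (y ^ ε M A) * (z ^ rcd M M' A)))
proposition3 {n} M M' P x y z =
    expand (absentPower x) (presentPower y) (λ A → refl)
  , expand (presentOnly x) (absentOnly y) (λ A →
      trans (if-*ˡᵐ (isZero (cr M' A)) (isZero (nl M A)) (x ^ ι M' A) (y ^ ε M A) (Z A))
            (if-cond (x ^ ι M' A * y ^ ε M A * Z A) (sym (cong₂ _∧_ (spanning-isZero M' A) (indep-isZero M A)))))
  , expand (halved x) (halved y) (λ A → halved-y A ((x * ½) ^ (cr M' A + ι M' A)))
  , expand (halved x) (presentPower y) (λ A → refl)
  , expand (halved x) (presentOnly y) (λ A → if-*ᵐ (isZero (ε M A)) ((x * ½) ^ (cr M' A + ι M' A)) (y ^ nl M A) (Z A))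
  , expand (absentPower x) (halved y) (λ A → halved-y A ((x - 1ℚ) ^ cr M' A))
  , expand (absentOnly x) (halved y) (λ A →
      trans (if-*ˡ (isZero (ι M' A)) (x ^ cr M' A) ((y * ½) ^ (ε M A + nl M A)) (Z A))
            (cong (if isZero (ι M' A) then_else 0ℚ) (halved-y A (x ^ cr M' A))))
  , expand (presentOnly x) (presentPower y) (λ A →
      trans (if-*ˡ (isZero (cr M' A)) (x ^ ι M' A) ((y - 1ℚ) ^ nl M A) (Z A))
            (if-cond (x ^ ι M' A * (y - 1ℚ) ^ nl M A * Z A) (sym (spanning-isZero M' A))))
  , expand (absentPower x) (absentOnly y) (λ A →
      trans (if-*ᵐ (isZero (nl M A)) ((x - 1ℚ) ^ cr M' A) (y ^ ε M A) (Z A))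
            (if-cond ((x - 1ℚ) ^ cr M' A * y ^ ε M A * Z A) (sym (indep-isZero M A))))
  where
  Z : Subset n → ℚ
  Z A = z ^ rcd M M' A
  -- the halved y-weight counts ε + nl, the statement writes nl + ε
  halved-y : ∀ A p → p * (y * ½) ^ (ε M A + nl M A) * Z A ≡ p * (y * ½) ^ (nl M A + ε M A) * Z A
  halved-y A p = cong (λ k → p * (y * ½) ^ k * Z A) (ℕP.+-comm (ε M A) (nl M A))
  expand : (U : Weight x) (V : Weight y) {g : Subset n → ℚ} →
           (∀ A → Weight.w U (cr M' A) (ι M' A) * Weight.w V (ε M A) (nl M A) * Z A ≡ g A) →
           tutte M M' x y z ≡ ΣSub n g
  expand U V summand = trans (activity-expansion M M' P x y z U V) (ΣSub-cong _ _ summand)
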